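{- Let $k\geq 3$ and let $\sigma$ be the classical pattern $2\mbox{ - }3\mbox{ - }\cdots\mbox{ - }k\mbox{ - }1$ (the permutation $23\cdots k1$). For $n\ge0$ let $ud(n)$, $dd(n)$, $uu(n)$, $du(n)$ be, respectively, the numbers of up-down, down-down, up-up and down-up permutations of length $n$ avoiding both $1\mbox{ - }3\mbox{ - }2$ and $\sigma$, with generating functions $UD(x)=\sum_n ud(n)x^n$, $DD(x)=\sum_n dd(n)x^n$, $UU(x)=\sum_n uu(n)x^n$, $DU(x)=\sum_n du(n)x^n$. Writing $U_r$ for $U_r\!\left(\frac1{2x}\right)$, (1) $UD(x)=\dfrac{xU_{k-4}}{U_{k-2}}$; (2) $DD(x)=\dfrac{x^{k-2}+U_{k-4}}{U_{k-2}}$; (3) $UU(x)=\dfrac{U_{k-3}^2}{U_{k-2}^2}$; (4) $DU(x)=\dfrac{x}{U_{k-2}^2}\Bigl(x^{k-3}\bigl(U_{k-3}+xU_{k-2}\bigr)+2U_{k-3}^2+U_{k-4}^2-2\Bigr)$.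
   Context: A permutation of length $n$ is a word $\pi_1\cdots\pi_n$ containing each of $1,\dots,n$ exactly once. A classical pattern $\tau$ (written with dashes between letters) occurs in $\pi$ if some subsequence $\pi_{i_1}\cdots\pi_{i_m}$ ($i_1<\dots<i_m$) is order-isomorphic to $\tau$; otherwise $\pi$ avoids $\tau$. $1\mbox{ - }3\mbox{ - }2$ is the classical pattern $132$. For $n\ge2$: up-down permutations satisfy $\pi_1<\pi_2>\pi_3<\cdots$ and have odd length; up-up ones satisfy $\pi_1<\pi_2>\pi_3<\cdots$ and have even length; down-up ones satisfy $\pi_1>\pi_2<\pi_3>\cdots$ and have odd length; down-down ones satisfy $\pi_1>\pi_2<\pi_3>\cdots$ and have even length. For $n=0,1$ these classes are empty. $U_r$ is the Chebyshev polynomial of the second kind, $U_r(\cos\theta)=\sin((r+1)\theta)/\sin\theta$; in particular $U_{ -1}=0$, $U_0=1$, $U_1(t)=2t$, $U_r(t)=2tU_{r-1}(t)-U_{r-2}(t)$. -}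

module Defs where

open import Data.Nat as ℕ using (ℕ; zero; suc; _<_; _>_; _≤_; _∸_; _%_)
open import Data.Integer as ℤ using (ℤ; +_)
open import Data.List using (List; []; _∷_; _++_; [_]; map; upTo; length; lookup; foldr)
open import Data.List.Membership.Propositional using (_∈_)
open import Data.List.Relation.Unary.Unique.Propositional using (Unique)
open import Data.List.Relation.Binary.Permutation.Propositional using (_↭_)
open import Data.List.Relation.Binary.Sublist.Propositional using (_⊆_)
open import Data.Fin using (Fin; cast)
open import Data.Product using (Σ; Σ-syntax; ∃; ∃-syntax; _×_; _,_)
open import Data.Unit using (⊤)
open import Function.Bundles using (_⇔_)
open import Relation.Nullary using (¬_)
open import Relation.Binary.PropositionalEquality using (_≡_)

IsPerm : ℕ → List ℕ → Set
IsPerm n π = π ↭ map suc (upTo n)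

OrderIso : List ℕ → List ℕ → Set
OrderIso a b = Σ[ e ∈ length a ≡ length b ]
  (∀ (i j : Fin (length a)) →
     (lookup a i < lookup a j) ⇔ (lookup b (cast e i) < lookup b (cast e j)))

Contains : List ℕ → List ℕ → Set
Contains π τ = ∃[ s ] (s ⊆ π × OrderIso s τ)

Avoids : List ℕ → List ℕ → Set
Avoids π τ = ¬ Contains π τ

p132 : List ℕ
p132 = 1 ∷ 3 ∷ 2 ∷ []

sigma : ℕ → List ℕ
sigma k = map (λ i → 2 ℕ.+ i) (upTo (k ∸ 1)) ++ [ 1 ]

Av : ℕ → List ℕ → Set
Av k π = Avoids π p132 × Avoids π (sigma k)

AltUp AltDown : List ℕ → Set
AltUp (a ∷ b ∷ r) = a < b × AltDown (b ∷ r)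
AltUp _ = ⊤
AltDown (a ∷ b ∷ r) = a > b × AltUp (b ∷ r)
AltDown _ = ⊤

Odd Even : ℕ → Set
Odd n = n % 2 ≡ 1
Even n = n % 2 ≡ 0

UpDown DownDown UpUp DownUp : ℕ → ℕ → List ℕ → Set
UpDown   k n π = IsPerm n π × 2 ≤ n × Odd n  × AltUp π   × Av k π
UpUp     k n π = IsPerm n π × 2 ≤ n × Even n × AltUp π   × Av k π
DownUp   k n π = IsPerm n π × 2 ≤ n × Odd n  × AltDown π × Av k π
DownDown k n π = IsPerm n π × 2 ≤ n × Even n × AltDown π × Av k π

HasCount : (List ℕ → Set) → ℕ → Set
HasCount P c = Σ[ L ∈ List (List ℕ) ]
  (Unique L × (∀ π → (π ∈ L) ⇔ P π) × length L ≡ c)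

-- Formal Laurent series over ℤ with finite pole order:
-- (s , f) represents x^(-s) · Σₙ f n xⁿ

PS : Set
PS = ℕ → ℤ

LS : Set
LS = ℕ × PS

shift : ℕ → PS → PS
shift zero    f n       = f n
shift (suc t) f zero    = + 0
shift (suc t) f (suc n) = shift t f n

sumℤ : List ℤ → ℤ
sumℤ = foldr ℤ._+_ (+ 0)

conv : PS → PS → PS
conv f g n = sumℤ (map (λ i → f i ℤ.* g (n ∸ i)) (upTo (suc n)))

infixl 6 _⊕_ _⊖_
infixl 7 _⊗_
infix 4 _≈_

_⊗_ : LS → LS → LS
(s , f) ⊗ (t , g) = (s ℕ.+ t , conv f g)

_⊕_ : LS → LS → LS
(s , f) ⊕ (t , g) = (s ℕ.+ t , λ n → shift t f n ℤ.+ shift s g n)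

⊖_ : LS → LS
⊖ (s , f) = (s , λ n → ℤ.- f n)

_⊖_ : LS → LS → LS
a ⊖ b = a ⊕ (⊖ b)

-- equality of Laurent series: x^(-s) f = x^(-t) g  iff  x^t f = x^s g
_≈_ : LS → LS → Set
(s , f) ≈ (t , g) = ∀ n → shift t f n ≡ shift s g n

const : ℤ → LS
const c = (0 , λ { zero → c ; (suc _) → + 0 })

xpow : ℕ → LS
xpow m = (0 , shift m (λ { zero → + 1 ; (suc _) → + 0 }))

xinv : LS
xinv = (1 , λ { zero → + 1 ; (suc _) → + 0 })

GF : (ℕ → ℕ) → LS
GF a = (0 , λ n → + a n)

-- Chebyshev polynomials of the second kind evaluated at t = 1/(2x),
-- with index offset by one:  Uc j = U_(j-1)(1/(2x)).  Recurrence
-- U_(-1) = 0, U_0 = 1, U_r(t) = 2t·U_(r-1)(t) − U_(r-2)(t), where 2t = x^(-1).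
Uc : ℕ → LS
Uc zero = const (+ 0)
Uc (suc zero) = const (+ 1)
Uc (suc (suc j)) = xinv ⊗ Uc (suc j) ⊖ Uc j

module Submission where

-- Every 132-avoiding permutation of length m + 1 factors uniquely as α′ (m+1) β, where every
-- entry of α′ exceeds every entry of β; lowering α′ by |β| gives a 132-avoiding permutation α,
-- and we write glue α β for the factored permutation.  Along this factorisation everything
-- splits: the maximum is a peak, so in an up-down permutation |α| is odd and α, β are up-down;
-- an increasing subsequence of length h + 1 lies in β or comes from one of length h in α; and
-- an occurrence of 23⋯k1 lies in α, or in β, or consists of k − 2 increasing entries of α, the
-- maximum and an entry of β.  This turns the counting sequences into convolution recurrences,
-- i.e. the generating functions A_h of up-down permutations avoiding 132 and 12⋯(h+1) satisfy
-- A_(h+1) = x (1 + A_h A_(h+1)), and those of the four classes are expressed through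
-- A_(k−3), the analogous down-down series D_(k−3), and Q = x + x A_(k−3) Q.  With the
-- Chebyshev recurrence U_(h+1) = x⁻¹ U_h − U_(h−1) one gets A_h = U_(h−1)/U_h by induction, and
-- each claimed identity becomes a polynomial identity in x, x⁻¹ and the U's modulo these
-- relations, checked by the ring solver in the ring of Laurent series over ℤ.

open import Defs

open import Algebra.Bundles using (CommutativeRing)
open import Algebra.Structures using (IsCommutativeRing)
import Algebra.Solver.Ring.AlmostCommutativeRing as ACR
open import Data.Bool using (Bool; true; false; not; _xor_; if_then_else_)
import Data.Bool.Properties as Bool
open import Data.Empty using (⊥; ⊥-elim)
open import Data.Fin using (Fin; toℕ; fromℕ<; cast)
import Data.Fin.Properties as Fin
open import Data.Integer as ℤ using (ℤ; +_) renaming (_+_ to _+ᶻ_; _*_ to _*ᶻ_; -_ to -ᶻ_)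
import Data.Integer.Properties as ℤₚ
import Data.Integer.Tactic.RingSolver as ℤ-Solver
open import Data.List as List using (List; []; _∷_; _++_; map; length; upTo; applyUpTo)
import Data.List.Properties as List
open import Data.List.Membership.Propositional using (_∈_; _∉_)
import Data.List.Membership.Propositional.Properties as ∈
open import Data.List.Relation.Binary.Permutation.Propositional as ↭ using (_↭_; ↭-sym; ↭⇒↭ₛ)
import Data.List.Relation.Binary.Permutation.Propositional.Properties as ↭
import Data.List.Relation.Binary.Permutation.Setoid.Properties as ↭ₛ
import Data.List.Relation.Binary.Sublist.Propositional as Sublist
open Sublist using (_⊆_; []; _∷_; _∷ʳ_)
import Data.List.Relation.Binary.Sublist.Propositional.Properties as Sublistₚ
open import Data.List.Relation.Unary.All as All using (All; []; _∷_)
import Data.List.Relation.Unary.All.Properties as All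
open import Data.List.Relation.Unary.AllPairs as AllPairs using (AllPairs; []; _∷_)
import Data.List.Relation.Unary.AllPairs.Properties as AllPairs
open import Data.List.Relation.Unary.Any using (here; there)
open import Data.List.Relation.Unary.Unique.Propositional using (Unique)
import Data.List.Relation.Unary.Unique.Propositional.Properties as Unique
open import Data.Maybe using (Maybe; just; nothing)
open import Data.Nat as ℕ using (ℕ; zero; suc; _+_; _*_; _∸_; _≤_; _<_; z≤n; s≤s)
open import Data.Nat.Induction using (<-rec)
open import Data.Nat.ListAction using (sum)
import Data.Nat.Properties as ℕ
import Data.Nat.Tactic.RingSolver as ℕ-Solver
open import Data.Product as Product using (∃; ∃₂; _×_; _,_; proj₁; proj₂)
open import Data.Sum as Sum using (_⊎_; inj₁; inj₂; [_,_]′)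
open import Data.Unit using (tt)
open import Function using (_∘_; id; case_of_)
open import Function.Bundles using (_⇔_; mk⇔; Equivalence)
open import Function.Construct.Composition using (_⇔-∘_)
open import Function.Construct.Symmetry using (⇔-sym)
open import Level using (0ℓ)
open import Relation.Binary.Definitions using (tri<; tri≈; tri>)
open import Relation.Binary.PropositionalEquality
open import Relation.Binary.Structures using (IsEquivalence)
open import Relation.Nullary using (¬_; Dec; yes; no)
open import Relation.Unary using (Pred; _∪_)

open Equivalence using (to; from)

Class : Set₁
Class = Pred (List ℕ) 0ℓ

Unique⇒length≤ : {xs ys : List (List ℕ)} → Unique xs → (∀ {x} → x ∈ xs → x ∈ ys) →
                 length xs ≤ length ys
Unique⇒length≤ {[]} _ _ = z≤n
Unique⇒length≤ {x ∷ xs} {ys} (x∉xs ∷ u) xs⊆ys with ∈.∈-∃++ (xs⊆ys (here refl))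
... | ys₁ , ys₂ , refl = begin
  suc (length xs)             ≤⟨ s≤s (Unique⇒length≤ u xs⊆ys₁ys₂) ⟩
  suc (length (ys₁ ++ ys₂))   ≡⟨ cong suc (List.length-++ ys₁) ⟩
  suc (length ys₁ + length ys₂) ≡⟨ ℕ.+-suc (length ys₁) (length ys₂) ⟨
  length ys₁ + length (x ∷ ys₂) ≡⟨ List.length-++ ys₁ ⟨
  length (ys₁ ++ x ∷ ys₂)     ∎
  where
  open ℕ.≤-Reasoning
  xs⊆ys₁ys₂ : ∀ {y} → y ∈ xs → y ∈ ys₁ ++ ys₂
  xs⊆ys₁ys₂ {y} y∈xs with ↭.∈-resp-↭ (↭.shift x ys₁ ys₂) (xs⊆ys (there y∈xs))
  ... | here refl = ⊥-elim (All.All¬⇒¬Any x∉xs y∈xs)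
  ... | there y∈ = y∈

HasCount-unique : ∀ {P : Class} {a b} → HasCount P a → HasCount P b → a ≡ b
HasCount-unique (L₁ , u₁ , m₁ , refl) (L₂ , u₂ , m₂ , refl) =
  ℕ.≤-antisym (Unique⇒length≤ u₁ λ {x} x∈ → from (m₂ x) (to (m₁ x) x∈))
              (Unique⇒length≤ u₂ λ {x} x∈ → from (m₁ x) (to (m₂ x) x∈))

HasCount-resp : ∀ {P Q : Class} {a} → (∀ π → P π ⇔ Q π) → HasCount P a → HasCount Q a
HasCount-resp P⇔Q (L , u , m , l) =
  L , u , (λ π → mk⇔ (to (P⇔Q π) ∘ to (m π)) (from (m π) ∘ from (P⇔Q π))) , l

HasCount-∅ : ∀ {P : Class} → (∀ π → ¬ P π) → HasCount P 0
HasCount-∅ ¬P = [] , [] , (λ π → mk⇔ (λ ()) (⊥-elim ∘ ¬P π)) , refl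

HasCount-singleton : ∀ {P : Class} π₀ → (∀ π → P π ⇔ π ≡ π₀) → HasCount P 1
HasCount-singleton π₀ P⇔≡π₀ =
  π₀ ∷ [] , [] ∷ [] ,
  (λ π → mk⇔ (λ { (here refl) → from (P⇔≡π₀ π) refl }) (here ∘ to (P⇔≡π₀ π))) , refl

HasCount-∪ : ∀ {P Q : Class} {a b} → HasCount P a → HasCount Q b →
             (∀ π → P π → Q π → ⊥) → HasCount (P ∪ Q) (a + b)
HasCount-∪ {P} {Q} (L₁ , u₁ , m₁ , l₁) (L₂ , u₂ , m₂ , l₂) disjoint =
  L₁ ++ L₂ ,
  Unique.++⁺ u₁ u₂ (λ {π} (π∈L₁ , π∈L₂) → disjoint π (to (m₁ π) π∈L₁) (to (m₂ π) π∈L₂)) ,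
  (λ π → mk⇔ (member π ∘ ∈.∈-++⁻ L₁)
             (λ { (inj₁ p) → ∈.∈-++⁺ˡ (from (m₁ π) p) ; (inj₂ q) → ∈.∈-++⁺ʳ L₁ (from (m₂ π) q) })) ,
  trans (List.length-++ L₁) (cong₂ _+_ l₁ l₂)
  where
  member : ∀ π → π ∈ L₁ ⊎ π ∈ L₂ → P π ⊎ Q π
  member π (inj₁ π∈) = inj₁ (to (m₁ π) π∈)
  member π (inj₂ π∈) = inj₂ (to (m₂ π) π∈)

module _ (g : List ℕ → List ℕ → List ℕ) where

  products : List (List ℕ) → List (List ℕ) → List (List ℕ)
  products []       ys = []
  products (x ∷ xs) ys = map (g x) ys ++ products xs ys

  length-products : ∀ xs ys → length (products xs ys) ≡ length xs * length ys
  length-products []       ys = refl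
  length-products (x ∷ xs) ys =
    trans (List.length-++ (map (g x) ys)) (cong₂ _+_ (List.length-map (g x) ys) (length-products xs ys))

  ∈-products⁻ : ∀ xs ys {π} → π ∈ products xs ys → ∃₂ λ α β → α ∈ xs × β ∈ ys × π ≡ g α β
  ∈-products⁻ (x ∷ xs) ys π∈ with ∈.∈-++⁻ (map (g x) ys) π∈
  ... | inj₁ π∈gx = let β , β∈ , e = ∈.∈-map⁻ (g x) π∈gx in x , β , here refl , β∈ , e
  ... | inj₂ π∈′ = let α , β , α∈ , β∈ , e = ∈-products⁻ xs ys π∈′ in α , β , there α∈ , β∈ , e

  ∈-products⁺ : ∀ xs ys {α β} → α ∈ xs → β ∈ ys → g α β ∈ products xs ys
  ∈-products⁺ (x ∷ xs) ys (here refl) β∈ = ∈.∈-++⁺ˡ (∈.∈-map⁺ (g x) β∈)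
  ∈-products⁺ (x ∷ xs) ys (there α∈) β∈ = ∈.∈-++⁺ʳ (map (g x) ys) (∈-products⁺ xs ys α∈ β∈)

  Unique-products : ∀ xs ys → Unique xs → Unique ys →
    (∀ {α α′ β β′} → α ∈ xs → α′ ∈ xs → β ∈ ys → β′ ∈ ys → g α β ≡ g α′ β′ → α ≡ α′ × β ≡ β′) →
    Unique (products xs ys)
  Unique-products []       ys _           _  _   = []
  Unique-products (x ∷ xs) ys (x∉xs ∷ ux) uy inj =
    Unique.++⁺ (Unique-map-injectiveOn uy (λ β∈ β′∈ → proj₂ ∘ inj (here refl) (here refl) β∈ β′∈))
               (Unique-products xs ys ux uy (λ α∈ α′∈ → inj (there α∈) (there α′∈)))
               disjoint
    where
    disjoint : ∀ {π} → π ∈ map (g x) ys × π ∈ products xs ys → ⊥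
    disjoint (π∈gx , π∈) with ∈.∈-map⁻ (g x) π∈gx | ∈-products⁻ xs ys π∈
    ... | β , β∈ , refl | α , β′ , α∈ , β′∈ , e =
      All.All¬⇒¬Any x∉xs (subst (_∈ xs) (sym (proj₁ (inj (here refl) (there α∈) β∈ β′∈ e))) α∈)
    Unique-map-injectiveOn : ∀ {f : List ℕ → List ℕ} {zs} → Unique zs →
      (∀ {z z′} → z ∈ zs → z′ ∈ zs → f z ≡ f z′ → z ≡ z′) → Unique (map f zs)
    Unique-map-injectiveOn {zs = []} [] _ = []
    Unique-map-injectiveOn {f = f} {z ∷ zs} (z∉ ∷ u) inj′ =
      All.map⁺ (All.tabulate λ {z′} z′∈ fz≡fz′ →
                  All.All¬⇒¬Any z∉ (subst (_∈ zs) (sym (inj′ (here refl) (there z′∈) fz≡fz′)) z′∈)) ∷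
      Unique-map-injectiveOn u (λ z∈ z′∈ → inj′ (there z∈) (there z′∈))

HasCount-product : ∀ {P Q : Class} {a b} (g : List ℕ → List ℕ → List ℕ) → HasCount P a → HasCount Q b →
  (∀ {α α′ β β′} → P α → P α′ → Q β → Q β′ → g α β ≡ g α′ β′ → α ≡ α′ × β ≡ β′) →
  HasCount (λ π → ∃₂ λ α β → P α × Q β × π ≡ g α β) (a * b)
HasCount-product g (L₁ , u₁ , m₁ , l₁) (L₂ , u₂ , m₂ , l₂) inj =
  products g L₁ L₂ ,
  Unique-products g L₁ L₂ u₁ u₂ (λ α∈ α′∈ β∈ β′∈ → inj (to (m₁ _) α∈) (to (m₁ _) α′∈) (to (m₂ _) β∈) (to (m₂ _) β′∈)) ,
  (λ π → mk⇔ (λ π∈ → let α , β , α∈ , β∈ , e = ∈-products⁻ g L₁ L₂ π∈ in α , β , to (m₁ α) α∈ , to (m₂ β) β∈ , e)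
             (λ { (α , β , Pα , Qβ , refl) → ∈-products⁺ g L₁ L₂ (from (m₁ α) Pα) (from (m₂ β) Qβ) })) ,
  trans (length-products g L₁ L₂) (cong₂ _*_ l₁ l₂)

⋃< : (ℕ → Class) → ℕ → Class
⋃< R t π = ∃ λ i → i < t × R i π

Disjoint : (ℕ → Class) → Set
Disjoint R = ∀ {i i′ π} → R i π → R i′ π → i ≡ i′

private
  ⋃<-suc : ∀ R t π → (R 0 ∪ ⋃< (R ∘ suc) t) π ⇔ ⋃< R (suc t) π
  ⋃<-suc R t π = mk⇔ (λ { (inj₁ x) → 0 , s≤s z≤n , x ; (inj₂ (i , i<t , x)) → suc i , s≤s i<t , x })
                     (λ { (zero , _ , x) → inj₁ x ; (suc i , s≤s i<t , x) → inj₂ (i , i<t , x) })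

  Disjoint-suc : ∀ {R} → Disjoint R → Disjoint (R ∘ suc)
  Disjoint-suc disj x y = ℕ.suc-injective (disj x y)

  Disjoint-0 : ∀ {R} → Disjoint R → ∀ t π → R 0 π → ⋃< (R ∘ suc) t π → ⊥
  Disjoint-0 disj t π x (i , _ , y) with disj x y
  ... | ()

HasCount-⋃< : ∀ (R : ℕ → Class) (r : ℕ → ℕ) → (∀ i → HasCount (R i) (r i)) → Disjoint R →
              ∀ t → HasCount (⋃< R t) (sum (applyUpTo r t))
HasCount-⋃< R r c disj zero    = HasCount-∅ λ { π (i , () , _) }
HasCount-⋃< R r c disj (suc t) =
  HasCount-resp (⋃<-suc R t)
    (HasCount-∪ (c 0) (HasCount-⋃< (R ∘ suc) (r ∘ suc) (c ∘ suc) (Disjoint-suc {R} disj) t)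
                (Disjoint-0 {R} disj t))

∃HasCount-⋃< : ∀ (R : ℕ → Class) t → (∀ i → i < t → ∃ (HasCount (R i))) → Disjoint R →
               ∃ (HasCount (⋃< R t))
∃HasCount-⋃< R zero    c disj = 0 , HasCount-∅ λ { π (i , () , _) }
∃HasCount-⋃< R (suc t) c disj =
  let a , ca = c 0 (s≤s z≤n)
      b , cb = ∃HasCount-⋃< (R ∘ suc) t (λ i i<t → c (suc i) (s≤s i<t)) (Disjoint-suc {R} disj)
  in a + b , HasCount-resp (⋃<-suc R t) (HasCount-∪ ca cb (Disjoint-0 {R} disj t))

range : ℕ → List ℕ
range n = map suc (upTo n)

IsPerm-length : ∀ {n π} → IsPerm n π → length π ≡ n
IsPerm-length {n} p = trans (↭.↭-length p) (trans (List.length-map suc (upTo n)) (List.length-upTo n))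

IsPerm-0 : ∀ {π} → IsPerm 0 π → π ≡ []
IsPerm-0 {[]}    _ = refl
IsPerm-0 {_ ∷ _} p with IsPerm-length p
... | ()

IsPerm-self : ∀ {n π} → IsPerm n π → IsPerm (length π) π
IsPerm-self {π = π} p = subst (λ n → IsPerm n π) (sym (IsPerm-length p)) p

∈-range⁻ : ∀ {n x} → x ∈ range n → 1 ≤ x × x ≤ n
∈-range⁻ x∈ with ∈.∈-map⁻ suc x∈
... | y , y∈ , refl = s≤s z≤n , ∈.∈-upTo⁻ y∈

∈-range⁺ : ∀ {n x} → 1 ≤ x → x ≤ n → x ∈ range n
∈-range⁺ {x = suc x} _ x≤n = ∈.∈-map⁺ suc (∈.∈-upTo⁺ x≤n)

IsPerm-bounds : ∀ {n π x} → IsPerm n π → x ∈ π → 1 ≤ x × x ≤ n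
IsPerm-bounds p = ∈-range⁻ ∘ ↭.∈-resp-↭ p

glue : List ℕ → List ℕ → List ℕ
glue α β = map (_+ length β) α ++ suc (length α + length β) ∷ β

length-glue : ∀ α β → length (glue α β) ≡ suc (length α + length β)
length-glue α β = begin
  length (map (_+ length β) α ++ _ ∷ β)        ≡⟨ List.length-++ (map (_+ length β) α) ⟩
  length (map (_+ length β) α) + suc (length β) ≡⟨ cong (_+ suc (length β)) (List.length-map _ α) ⟩
  length α + suc (length β)                    ≡⟨ ℕ.+-suc (length α) (length β) ⟩
  suc (length α + length β)                    ∎
  where open ≡-Reasoning

++-∷-injective : ∀ {y : ℕ} xs xs′ {ys ys′} → y ∉ xs → y ∉ xs′ →
                 xs ++ y ∷ ys ≡ xs′ ++ y ∷ ys′ → xs ≡ xs′ × ys ≡ ys′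
++-∷-injective []       []         _    _     e = refl , List.∷-injectiveʳ e
++-∷-injective []       (x′ ∷ xs′) _    y∉xs′ e = ⊥-elim (y∉xs′ (here (List.∷-injectiveˡ e)))
++-∷-injective (x ∷ xs) []         y∉xs _     e = ⊥-elim (y∉xs (here (sym (List.∷-injectiveˡ e))))
++-∷-injective (x ∷ xs) (x′ ∷ xs′) y∉xs y∉xs′ e with List.∷-injective e
... | refl , e′ = let xs≡ , ys≡ = ++-∷-injective xs xs′ (y∉xs ∘ there) (y∉xs′ ∘ there) e′
                  in cong (x ∷_) xs≡ , ys≡

max∉raised : ∀ {α} k → IsPerm (length α) α → suc (length α + k) ∉ map (_+ k) α
max∉raised k pα y∈ with ∈.∈-map⁻ (_+ k) y∈
... | x , x∈ , e = ℕ.<-irrefl (sym e) (s≤s (ℕ.+-monoˡ-≤ k (proj₂ (IsPerm-bounds pα x∈))))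

glue-max-cong : ∀ {α α′ β β′} → glue α β ≡ glue α′ β′ →
                suc (length α + length β) ≡ suc (length α′ + length β′)
glue-max-cong {α} {α′} {β} {β′} e = trans (sym (length-glue α β)) (trans (cong length e) (length-glue α′ β′))

glue-injective : ∀ {α α′ β β′} → IsPerm (length α) α → IsPerm (length α′) α′ →
                 glue α β ≡ glue α′ β′ → α ≡ α′ × β ≡ β′
glue-injective {α} {α′} {β} {β′} pα pα′ e
  with raised≡ , refl ← ++-∷-injective (map (_+ length β) α) (map (_+ length β′) α′)
         (max∉raised (length β) pα) (subst (_∉ map (_+ length β′) α′) (sym (glue-max-cong e)) (max∉raised (length β′) pα′))
         (trans e (cong (λ M → map (_+ length β′) α′ ++ M ∷ β′) (sym (glue-max-cong e))))
  = List.map-injective (ℕ.+-cancelʳ-≡ _ _ _) raised≡ , refl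

PermFamily : (ℕ → Class) → Set
PermFamily P = ∀ {i α} → P i α → IsPerm i α

GlueClass : (ℕ → Class) → (ℕ → Class) → ℕ → Class
GlueClass P Q m π = ∃ λ i → i < suc m × ∃₂ λ α β → P i α × Q (m ∸ i) β × π ≡ glue α β

convℕ : (ℕ → ℕ) → (ℕ → ℕ) → ℕ → ℕ
convℕ p q m = sum (applyUpTo (λ i → p i * q (m ∸ i)) (suc m))

GlueWithMax : (ℕ → Class) → ℕ → Class
GlueWithMax P m π = ∃ λ α → P m α × π ≡ glue α []

range-suc : ∀ n → range (suc n) ≡ range n ++ suc n ∷ []
range-suc n = trans (cong (map suc) (sym (List.upTo-∷ʳ n))) (List.map-++ suc (upTo n) (n ∷ []))

range-+ : ∀ i j → range (i + j) ≡ range j ++ map (_+ j) (range i)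
range-+ zero    j = sym (List.++-identityʳ (range j))
range-+ (suc i) j = begin
  range (suc (i + j))                                      ≡⟨ range-suc (i + j) ⟩
  range (i + j) ++ suc (i + j) ∷ []                        ≡⟨ cong (_++ suc (i + j) ∷ []) (range-+ i j) ⟩
  (range j ++ map (_+ j) (range i)) ++ suc (i + j) ∷ []    ≡⟨ List.++-assoc (range j) _ _ ⟩
  range j ++ (map (_+ j) (range i) ++ suc i + j ∷ [])      ≡⟨ cong (range j ++_) (List.map-++ (_+ j) (range i) (suc i ∷ [])) ⟨
  range j ++ map (_+ j) (range i ++ suc i ∷ [])            ≡⟨ cong (λ xs → range j ++ map (_+ j) xs) (range-suc i) ⟨
  range j ++ map (_+ j) (range (suc i))                    ∎
  where open ≡-Reasoning

Unique-range : ∀ n → Unique (range n)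
Unique-range n = Unique.map⁺ ℕ.suc-injective (Unique.upTo⁺ n)

Unique-resp-↭ : ∀ {xs ys : List ℕ} → xs ↭ ys → Unique xs → Unique ys
Unique-resp-↭ p = ↭ₛ.Unique-resp-↭ (setoid ℕ) (↭⇒↭ₛ p)

Unique-++⇒disjoint : ∀ (xs : List ℕ) {ys x} → Unique (xs ++ ys) → x ∈ xs → x ∉ ys
Unique-++⇒disjoint (x ∷ xs) (x∉ ∷ _) (here refl) x∈ys = All.All¬⇒¬Any (All.++⁻ʳ xs x∉) x∈ys
Unique-++⇒disjoint (y ∷ xs) (_ ∷ u)  (there x∈) x∈ys = Unique-++⇒disjoint xs u x∈ x∈ys

module _ {P : ℕ → Class} (permP : PermFamily P) where

  private
    glue-injectiveOn : ∀ {i i′ α α′ β β′} → P i α → P i′ α′ → glue α β ≡ glue α′ β′ → α ≡ α′ × β ≡ β′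
    glue-injectiveOn Pα Pα′ = glue-injective (IsPerm-self (permP Pα)) (IsPerm-self (permP Pα′))

    Disjoint-glue : ∀ {Q : ℕ → Class} m → Disjoint (λ i π → ∃₂ λ α β → P i α × Q (m ∸ i) β × π ≡ glue α β)
    Disjoint-glue _ (α , β , Pα , _ , refl) (α′ , β′ , Pα′ , _ , e) =
      trans (sym (IsPerm-length (permP Pα)))
            (trans (cong length (proj₁ (glue-injectiveOn Pα Pα′ e))) (IsPerm-length (permP Pα′)))

  HasCount-GlueClass : ∀ {Q : ℕ → Class} m {p q} → (∀ i → HasCount (P i) (p i)) → (∀ j → HasCount (Q j) (q j)) →
                       HasCount (GlueClass P Q m) (convℕ p q m)
  HasCount-GlueClass {Q} m cP cQ =
    HasCount-⋃< _ _ (λ i → HasCount-product glue (cP i) (cQ (m ∸ i)) (λ Pα Pα′ _ _ → glue-injectiveOn Pα Pα′))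
                (Disjoint-glue {Q} m) (suc m)

  ∃HasCount-GlueClass : ∀ {Q : ℕ → Class} m → (∀ i → ∃ (HasCount (P i))) → (∀ j → j ≤ m → ∃ (HasCount (Q j))) →
                        ∃ (HasCount (GlueClass P Q m))
  ∃HasCount-GlueClass {Q} m cP cQ =
    ∃HasCount-⋃< _ (suc m)
      (λ i _ → let a , ca = cP i ; b , cb = cQ (m ∸ i) (ℕ.m∸n≤m m i) in
               a * b , HasCount-product glue ca cb (λ Pα Pα′ _ _ → glue-injectiveOn Pα Pα′))
      (Disjoint-glue {Q} m)

  HasCount-GlueWithMax : ∀ m {p} → HasCount (P m) p → HasCount (GlueWithMax P m) p
  HasCount-GlueWithMax m {p} c = subst (HasCount (GlueWithMax P m)) (ℕ.*-identityʳ p)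
    (HasCount-resp (λ π → mk⇔ (λ { (α , _ , Pα , refl , e) → α , Pα , e }) (λ { (α , Pα , e) → α , [] , Pα , refl , e }))
      (HasCount-product glue c (HasCount-singleton [] (λ _ → mk⇔ id id))
        (λ { Pα Pα′ refl refl → glue-injectiveOn Pα Pα′ })))

⊆-split : ∀ (xs : List ℕ) {ys s} → s ⊆ xs ++ ys → ∃₂ λ s₁ s₂ → s₁ ++ s₂ ≡ s × s₁ ⊆ xs × s₂ ⊆ ys
⊆-split []       p = [] , _ , refl , [] , p
⊆-split (x ∷ xs) (.x ∷ʳ p) with ⊆-split xs p
... | s₁ , s₂ , e , p₁ , p₂ = s₁ , s₂ , e , x ∷ʳ p₁ , p₂
⊆-split (x ∷ xs) (refl ∷ p) with ⊆-split xs p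
... | s₁ , s₂ , e , p₁ , p₂ = x ∷ s₁ , s₂ , cong (x ∷_) e , refl ∷ p₁ , p₂

⊆-map⁻ : ∀ (f : ℕ → ℕ) {s} xs → s ⊆ map f xs → ∃ λ t → t ⊆ xs × s ≡ map f t
⊆-map⁻ f []       [] = [] , [] , refl
⊆-map⁻ f (x ∷ xs) (.(f x) ∷ʳ p) with ⊆-map⁻ f xs p
... | t , q , e = t , x ∷ʳ q , e
⊆-map⁻ f (x ∷ xs) (refl ∷ p) with ⊆-map⁻ f xs p
... | t , q , e = x ∷ t , refl ∷ q , cong (f x ∷_) e

Increasing : List ℕ → Set
Increasing = AllPairs _<_

Has132 : List ℕ → Set
Has132 π = ∃ λ a → ∃ λ b → ∃ λ c → (a ∷ b ∷ c ∷ []) ⊆ π × a < c × c < b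

HasIncreasing : ℕ → List ℕ → Set
HasIncreasing L π = ∃ λ s → s ⊆ π × Increasing s × length s ≡ L

-- an occurrence of 23⋯(r+1)1: an increasing run of length r followed by a smaller entry
HasSigma : ℕ → List ℕ → Set
HasSigma r π = ∃₂ λ s c → (s ++ c ∷ []) ⊆ π × Increasing s × All (c <_) s × length s ≡ r

Has132-⊆ : ∀ {xs ys} → xs ⊆ ys → Has132 xs → Has132 ys
Has132-⊆ p (a , b , c , q , r) = a , b , c , Sublist.⊆-trans q p , r

HasIncreasing-⊆ : ∀ {L xs ys} → xs ⊆ ys → HasIncreasing L xs → HasIncreasing L ys
HasIncreasing-⊆ p (s , q , i , l) = s , Sublist.⊆-trans q p , i , l

HasSigma-⊆ : ∀ {r xs ys} → xs ⊆ ys → HasSigma r xs → HasSigma r ys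
HasSigma-⊆ p (s , c , q , i) = s , c , Sublist.⊆-trans q p , i

HasIncreasing-pred : ∀ {L xs} → HasIncreasing (suc L) xs → HasIncreasing L xs
HasIncreasing-pred (x ∷ s , q , _ ∷ i , l) = s , Sublist.⊆-trans (x ∷ʳ Sublist.⊆-refl) q , i , ℕ.suc-injective l

HasSigma⇒HasIncreasing : ∀ {r xs} → HasSigma r xs → HasIncreasing r xs
HasSigma⇒HasIncreasing (s , c , q , i , _ , l) = s , Sublist.⊆-trans (Sublistₚ.++⁺ʳ (c ∷ []) Sublist.⊆-refl) q , i , l

length-∷ʳ : ∀ (xs : List ℕ) x → length (xs ++ x ∷ []) ≡ suc (length xs)
length-∷ʳ xs x = trans (List.length-++ xs) (ℕ.+-comm (length xs) 1)

¬Has132-short : ∀ {π} → length π < 3 → ¬ Has132 π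
¬Has132-short π<3 (a , b , c , p , _) = ℕ.<⇒≱ π<3 (Sublistₚ.length-mono-≤ p)

¬HasIncreasing-short : ∀ {L π} → length π < L → ¬ HasIncreasing L π
¬HasIncreasing-short π<L (s , p , _ , refl) = ℕ.<⇒≱ π<L (Sublistₚ.length-mono-≤ p)

¬HasSigma-short : ∀ {r π} → length π ≤ r → ¬ HasSigma r π
¬HasSigma-short π≤r (s , c , p , _ , _ , refl) =
  ℕ.<⇒≱ (s≤s π≤r) (subst (_≤ _) (length-∷ʳ s c) (Sublistₚ.length-mono-≤ p))

-- 0 past the end of the list; it is only ever evaluated at positions in range
nth : List ℕ → ℕ → ℕ
nth []       _       = 0
nth (x ∷ xs) zero    = x
nth (x ∷ xs) (suc p) = nth xs p

lookup≡nth : ∀ (w : List ℕ) (i : Fin (length w)) → List.lookup w i ≡ nth w (toℕ i)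
lookup≡nth (x ∷ w) Fin.zero    = refl
lookup≡nth (x ∷ w) (Fin.suc i) = lookup≡nth w i

<-cong-⇔ : ∀ {a b a′ b′} → a ≡ a′ → b ≡ b′ → (a < b) ⇔ (a′ < b′)
<-cong-⇔ refl refl = mk⇔ id id

_≅_ : List ℕ → List ℕ → Set
a ≅ b = length a ≡ length b ×
        (∀ {p q} → p < length a → q < length a → (nth a p < nth a q ⇔ nth b p < nth b q))

OrderIso⇒≅ : ∀ {a b} → OrderIso a b → a ≅ b
OrderIso⇒≅ {a} {b} (e , iso) = e , λ {p} {q} p< q< →
  lookup⇔nth b (cast e (fromℕ< p<)) (cast e (fromℕ< q<)) (toℕ-cast-fromℕ< p<) (toℕ-cast-fromℕ< q<)
  ⇔-∘ (iso (fromℕ< p<) (fromℕ< q<)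
  ⇔-∘ ⇔-sym (lookup⇔nth a (fromℕ< p<) (fromℕ< q<) (Fin.toℕ-fromℕ< p<) (Fin.toℕ-fromℕ< q<)))
  where
  lookup⇔nth : ∀ w i j {p q} → toℕ i ≡ p → toℕ j ≡ q → (List.lookup w i < List.lookup w j) ⇔ (nth w p < nth w q)
  lookup⇔nth w i j refl refl = <-cong-⇔ (lookup≡nth w i) (lookup≡nth w j)
  toℕ-cast-fromℕ< : ∀ {p} (p< : p < length a) → toℕ (cast e (fromℕ< p<)) ≡ p
  toℕ-cast-fromℕ< p< = trans (Fin.toℕ-cast e (fromℕ< p<)) (Fin.toℕ-fromℕ< p<)

≅⇒OrderIso : ∀ {a b} → a ≅ b → OrderIso a b
≅⇒OrderIso {a} {b} (e , iso) = e , λ i j →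
  <-cong-⇔ (sym (trans (lookup≡nth b (cast e i)) (cong (nth b) (Fin.toℕ-cast e i))))
           (sym (trans (lookup≡nth b (cast e j)) (cong (nth b) (Fin.toℕ-cast e j))))
  ⇔-∘ (iso (Fin.toℕ<n i) (Fin.toℕ<n j)
  ⇔-∘ <-cong-⇔ (lookup≡nth a i) (lookup≡nth a j))

HasShape : (ℕ → ℕ → Set) → List ℕ → Set
HasShape R w = ∀ {p q} → p < length w → q < length w → (nth w p < nth w q ⇔ R p q)

shapes⇒≅ : ∀ {R a b} → length a ≡ length b → HasShape R a → HasShape R b → a ≅ b
shapes⇒≅ e ha hb = e , λ p< q< → ⇔-sym (hb (subst (_ <_) e p<) (subst (_ <_) e q<)) ⇔-∘ ha p< q<

≅-shape : ∀ {R a b} → a ≅ b → HasShape R b → HasShape R a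
≅-shape (e , iso) hb p< q< = hb (subst (_ <_) e p<) (subst (_ <_) e q<) ⇔-∘ iso p< q<

Contains132⇔Has132 : ∀ {π} → Contains π p132 ⇔ Has132 π
Contains132⇔Has132 {π} = mk⇔ contains⇒ contains⇐
  where
  contains⇒ : Contains π p132 → Has132 π
  contains⇒ ([]                , _   , () , _)
  contains⇒ (_ ∷ []            , _   , () , _)
  contains⇒ (_ ∷ _ ∷ []        , _   , () , _)
  contains⇒ (_ ∷ _ ∷ _ ∷ _ ∷ _ , _   , () , _)
  contains⇒ (x ∷ y ∷ z ∷ []    , s⊆π , oi) =
    x , y , z , s⊆π , from (iso {0} {2} 0<3 2<3) 1<2 , from (iso {2} {1} 2<3 1<3) 2<3
    where
    iso : ∀ {p q} → p < 3 → q < 3 → (nth (x ∷ y ∷ z ∷ []) p < nth (x ∷ y ∷ z ∷ []) q ⇔ nth p132 p < nth p132 q)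
    iso = proj₂ (OrderIso⇒≅ oi)
    0<3 : 0 < 3
    0<3 = s≤s z≤n
    1<2 : 1 < 2
    1<2 = s≤s (s≤s z≤n)
    1<3 : 1 < 3
    1<3 = s≤s (s≤s z≤n)
    2<3 : 2 < 3
    2<3 = s≤s 1<2
  contains⇐ : Has132 π → Contains π p132
  contains⇐ (a , b , c , s⊆π , a<c , c<b) = a ∷ b ∷ c ∷ [] , s⊆π , ≅⇒OrderIso (refl , shape)
    where
    a<b : a < b
    a<b = ℕ.<-trans a<c c<b
    both : ∀ {P Q : Set} → P → Q → P ⇔ Q
    both p q = mk⇔ (λ _ → q) (λ _ → p)
    neither : ∀ {P Q : Set} → ¬ P → ¬ Q → P ⇔ Q
    neither ¬p ¬q = mk⇔ (⊥-elim ∘ ¬p) (⊥-elim ∘ ¬q)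
    shape : ∀ {p q} → p < 3 → q < 3 → (nth (a ∷ b ∷ c ∷ []) p < nth (a ∷ b ∷ c ∷ []) q ⇔ nth p132 p < nth p132 q)
    shape {0} {0} _ _ = neither (ℕ.<-irrefl refl) (ℕ.<-irrefl refl)
    shape {0} {1} _ _ = both a<b (ℕ.s≤s (ℕ.s≤s z≤n))
    shape {0} {2} _ _ = both a<c (ℕ.s≤s (ℕ.s≤s z≤n))
    shape {1} {0} _ _ = neither (ℕ.<-asym a<b) (λ { (s≤s ()) })
    shape {1} {1} _ _ = neither (ℕ.<-irrefl refl) (ℕ.<-irrefl refl)
    shape {1} {2} _ _ = neither (ℕ.<-asym c<b) (λ { (s≤s (s≤s ())) })
    shape {2} {0} _ _ = neither (ℕ.<-asym a<c) (λ { (s≤s ()) })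
    shape {2} {1} _ _ = both c<b (s≤s (s≤s (s≤s z≤n)))
    shape {2} {2} _ _ = neither (ℕ.<-irrefl refl) (ℕ.<-irrefl refl)
    shape {suc (suc (suc _))} (s≤s (s≤s (s≤s ()))) _
    shape {q = suc (suc (suc _))} _ (s≤s (s≤s (s≤s ())))

SigmaShape : ℕ → ℕ → ℕ → Set
SigmaShape r p q = q < r × (p ≡ r ⊎ p < q)

nth-∷ʳ-< : ∀ s c {p} → p < length s → nth (s ++ c ∷ []) p ≡ nth s p
nth-∷ʳ-< (x ∷ s) c {zero}  _         = refl
nth-∷ʳ-< (x ∷ s) c {suc p} (s≤s p<) = nth-∷ʳ-< s c p<

nth-∷ʳ-length : ∀ s c → nth (s ++ c ∷ []) (length s) ≡ c
nth-∷ʳ-length []      c = refl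
nth-∷ʳ-length (x ∷ s) c = nth-∷ʳ-length s c

nth-All : ∀ {P : ℕ → Set} {t q} → All P t → q < length t → P (nth t q)
nth-All {q = zero}  (px ∷ _)  _        = px
nth-All {q = suc q} (_ ∷ pxs) (s≤s q<) = nth-All pxs q<

All-nth : ∀ {P : ℕ → Set} s → (∀ {q} → q < length s → P (nth s q)) → All P s
All-nth []      _ = []
All-nth (y ∷ s) g = g (s≤s z≤n) ∷ All-nth s (g ∘ s≤s)

nth-Increasing : ∀ {s} → Increasing s → ∀ {p q} → p < q → q < length s → nth s p < nth s q
nth-Increasing (a ∷ i) {zero}  {suc q} _        (s≤s q<) = nth-All a q<
nth-Increasing (a ∷ i) {suc p} {suc q} (s≤s p<q) (s≤s q<) = nth-Increasing i p<q q<

Increasing-nth : ∀ s → (∀ {p q} → p < q → q < length s → nth s p < nth s q) → Increasing s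
Increasing-nth []      _ = []
Increasing-nth (x ∷ s) h =
  All-nth s (λ q< → h (s≤s z≤n) (s≤s q<)) ∷ Increasing-nth s (λ p<q q< → h (s≤s p<q) (s≤s q<))

private
  impossible : ∀ {P Q : Set} → ¬ P → ¬ Q → P ⇔ Q
  impossible ¬p ¬q = mk⇔ (⊥-elim ∘ ¬p) (⊥-elim ∘ ¬q)

  <-∷ʳ-cases : ∀ s c {p} → p < length (s ++ c ∷ []) → p ≡ length s ⊎ p < length s
  <-∷ʳ-cases s c p< with ℕ.m≤n⇒m<n∨m≡n (ℕ.≤-pred (subst (_ <_) (length-∷ʳ s c) p<))
  ... | inj₁ p<s = inj₂ p<s
  ... | inj₂ p≡s = inj₁ p≡s

SigmaShape-∷ʳ : ∀ {s c} → Increasing s → All (c <_) s → HasShape (SigmaShape (length s)) (s ++ c ∷ [])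
SigmaShape-∷ʳ {s} {c} inc c<s {p} {q} p< q< with <-∷ʳ-cases s c q< | <-∷ʳ-cases s c p<
... | inj₁ refl | inj₁ refl = impossible (ℕ.<-irrefl refl) (ℕ.<-irrefl refl ∘ proj₁)
... | inj₁ refl | inj₂ p<s = impossible
  (ℕ.<-asym (subst₂ _<_ (sym (nth-∷ʳ-length s c)) (sym (nth-∷ʳ-< s c p<s)) (nth-All c<s p<s)))
  (ℕ.<-irrefl refl ∘ proj₁)
... | inj₂ q<s | inj₁ refl = mk⇔ (λ _ → q<s , inj₁ refl)
  (λ _ → subst₂ _<_ (sym (nth-∷ʳ-length s c)) (sym (nth-∷ʳ-< s c q<s)) (nth-All c<s q<s))
... | inj₂ q<s | inj₂ p<s with ℕ.<-cmp p q
...   | tri< p<q _ _ = mk⇔ (λ _ → q<s , inj₂ p<q)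
  (λ _ → subst₂ _<_ (sym (nth-∷ʳ-< s c p<s)) (sym (nth-∷ʳ-< s c q<s)) (nth-Increasing inc p<q q<s))
...   | tri≈ _ refl _ = impossible (ℕ.<-irrefl refl) λ { (_ , inj₁ refl) → ℕ.<-irrefl refl p<s ; (_ , inj₂ h) → ℕ.<-irrefl refl h }
...   | tri> _ _ q<p = impossible
  (ℕ.<-asym (subst₂ _<_ (sym (nth-∷ʳ-< s c q<s)) (sym (nth-∷ʳ-< s c p<s)) (nth-Increasing inc q<p p<s)))
  λ { (_ , inj₁ refl) → ℕ.<-irrefl refl p<s ; (_ , inj₂ h) → ℕ.<-asym h q<p }

SigmaShape-∷ʳ⁻ : ∀ {s c} → HasShape (SigmaShape (length s)) (s ++ c ∷ []) → Increasing s × All (c <_) s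
SigmaShape-∷ʳ⁻ {s} {c} h =
  Increasing-nth s (λ p<q q<s →
    subst₂ _<_ (nth-∷ʳ-< s c (ℕ.<-trans p<q q<s)) (nth-∷ʳ-< s c q<s)
      (from (h (inner (ℕ.<-trans p<q q<s)) (inner q<s)) (q<s , inj₂ p<q))) ,
  All-nth s (λ q<s →
    subst₂ _<_ (nth-∷ʳ-length s c) (nth-∷ʳ-< s c q<s) (from (h last (inner q<s)) (q<s , inj₁ refl)))
  where
  last : length s < length (s ++ c ∷ [])
  last = subst (length s <_) (sym (length-∷ʳ s c)) ℕ.≤-refl
  inner : ∀ {p} → p < length s → p < length (s ++ c ∷ [])
  inner p<s = ℕ.<-trans p<s last

sigmaRun : ℕ → List ℕ
sigmaRun r = map (λ i → 2 + i) (upTo r)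

length-sigmaRun : ∀ r → length (sigmaRun r) ≡ r
length-sigmaRun r = trans (List.length-map (λ i → 2 + i) (upTo r)) (List.length-upTo r)

sigma-shape : ∀ r → HasShape (SigmaShape r) (sigma (suc r))
sigma-shape r = subst (λ k → HasShape (SigmaShape k) (sigma (suc r))) (length-sigmaRun r)
  (SigmaShape-∷ʳ (AllPairs.map⁺ (AllPairs.map (ℕ.+-monoʳ-< 2) (AllPairs.applyUpTo⁺₁ id r (λ i<j _ → i<j))))
                 (All.map⁺ (All.tabulate {xs = upTo r} λ _ → s≤s (s≤s z≤n))))

length-sigma : ∀ r → length (sigma (suc r)) ≡ suc r
length-sigma r = trans (length-∷ʳ (sigmaRun r) 1) (cong suc (length-sigmaRun r))

ContainsSigma⇔HasSigma : ∀ {π r} → Contains π (sigma (suc r)) ⇔ HasSigma r π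
ContainsSigma⇔HasSigma {π} {r} = mk⇔ contains⇒ contains⇐
  where
  contains⇒ : Contains π (sigma (suc r)) → HasSigma r π
  contains⇒ (s′ , s′⊆π , oi) with List.initLast s′ | OrderIso⇒≅ {s′} {sigma (suc r)} oi
  ... | List.[] | e , _ with trans e (length-sigma r)
  ...   | ()
  contains⇒ (s′ , s′⊆π , oi) | s List.∷ʳ′ c | ≅σ@(e , _) =
    let inc , below = SigmaShape-∷ʳ⁻ (subst (λ k → HasShape (SigmaShape k) (s ++ c ∷ [])) (sym length-s) shape)
    in s , c , s′⊆π , inc , below , length-s
    where
    shape : HasShape (SigmaShape r) (s ++ c ∷ [])
    shape = ≅-shape {SigmaShape r} {s ++ c ∷ []} {sigma (suc r)} ≅σ (sigma-shape r)
    length-s : length s ≡ r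
    length-s = ℕ.suc-injective (trans (sym (length-∷ʳ s c)) (trans e (length-sigma r)))
  contains⇐ : HasSigma r π → Contains π (sigma (suc r))
  contains⇐ (s , c , s⊆π , inc , below , refl) =
    s ++ c ∷ [] , s⊆π ,
    ≅⇒OrderIso {s ++ c ∷ []} {sigma (suc (length s))}
      (shapes⇒≅ {SigmaShape (length s)} {s ++ c ∷ []} {sigma (suc (length s))}
                (trans (length-∷ʳ s c) (sym (length-sigma (length s))))
                (SigmaShape-∷ʳ inc below) (sigma-shape (length s)))

Alt : Bool → List ℕ → Set
Alt true  = AltUp
Alt false = AltDown

Step : Bool → ℕ → ℕ → Set
Step true  x y = x < y
Step false x y = y < x

Alt-∷∷ : ∀ b {x y r} → Alt b (x ∷ y ∷ r) ⇔ (Step b x y × Alt (not b) (y ∷ r))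
Alt-∷∷ true  = mk⇔ id id
Alt-∷∷ false = mk⇔ id id

Alt-[] : ∀ b → Alt b []
Alt-[] true  = tt
Alt-[] false = tt

Alt-[_] : ∀ b {x} → Alt b (x ∷ [])
Alt-[ true  ] = tt
Alt-[ false ] = tt

flips : Bool → ℕ → Bool
flips b zero    = b
flips b (suc n) = not (flips b n)

flips-not : ∀ b n → flips (not b) n ≡ not (flips b n)
flips-not b zero    = refl
flips-not b (suc n) = cong not (flips-not b n)

isOdd : ℕ → Bool
isOdd = flips false

Alt-++-∷ : ∀ b xs y ys → Alt b (xs ++ y ∷ ys) ⇔ (Alt b (xs ++ y ∷ []) × Alt (flips b (length xs)) (y ∷ ys))
Alt-++-∷ b xs y ys = mk⇔ (split b xs) (λ (a₁ , a₂) → join b xs a₁ a₂)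
  where
  split : ∀ b xs → Alt b (xs ++ y ∷ ys) → Alt b (xs ++ y ∷ []) × Alt (flips b (length xs)) (y ∷ ys)
  split b []            a = Alt-[ b ] , a
  split b (x ∷ [])      a = from (Alt-∷∷ b) (proj₁ (to (Alt-∷∷ b) a) , Alt-[ not b ]) , proj₂ (to (Alt-∷∷ b) a)
  split b (x ∷ x′ ∷ xs) a with split (not b) (x′ ∷ xs) (proj₂ (to (Alt-∷∷ b) a))
  ... | a₁ , a₂ = from (Alt-∷∷ b) (proj₁ (to (Alt-∷∷ b) a) , a₁) ,
                  subst (λ c → Alt c (y ∷ ys)) (flips-not b (suc (length xs))) a₂
  join : ∀ b xs → Alt b (xs ++ y ∷ []) → Alt (flips b (length xs)) (y ∷ ys) → Alt b (xs ++ y ∷ ys)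
  join b []            a₁ a₂ = a₂
  join b (x ∷ [])      a₁ a₂ = from (Alt-∷∷ b) (proj₁ (to (Alt-∷∷ b) a₁) , a₂)
  join b (x ∷ x′ ∷ xs) a₁ a₂ =
    from (Alt-∷∷ b) (proj₁ (to (Alt-∷∷ b) a₁) ,
                     join (not b) (x′ ∷ xs) (proj₂ (to (Alt-∷∷ b) a₁))
                          (subst (λ c → Alt c (y ∷ ys)) (sym (flips-not b (suc (length xs)))) a₂))

Alt-∷ʳ-max : ∀ b xs {y} → All (_< y) xs → Alt b (xs ++ y ∷ []) ⇔ (Alt b xs × (xs ≡ [] ⊎ flips b (length xs) ≡ false))
Alt-∷ʳ-max b     []       _       = mk⇔ (λ _ → Alt-[] b , inj₁ refl) (λ _ → Alt-[ b ])
Alt-∷ʳ-max true  (x ∷ []) (x<y ∷ _) = mk⇔ (λ _ → tt , inj₂ refl) (λ _ → x<y , tt)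
Alt-∷ʳ-max false (x ∷ []) (x<y ∷ _) = mk⇔ (λ a → ⊥-elim (ℕ.<-asym x<y (proj₁ a))) (λ { (_ , inj₁ ()) ; (_ , inj₂ ()) })
Alt-∷ʳ-max b (x ∷ x′ ∷ xs) {y} (_ ∷ xs<y) = mk⇔
  (λ a → from (Alt-∷∷ b) (proj₁ (to (Alt-∷∷ b) a) , proj₁ (to IH (proj₂ (to (Alt-∷∷ b) a)))) ,
         inj₂ (subst (_≡ false) (flips-not b (suc (length xs))) (nonempty (proj₂ (to IH (proj₂ (to (Alt-∷∷ b) a)))))))
  (λ { (_ , inj₁ ()) ; (a , inj₂ e) → from (Alt-∷∷ b) (proj₁ (to (Alt-∷∷ b) a) ,
                         from IH (proj₂ (to (Alt-∷∷ b) a) , inj₂ (trans (flips-not b (suc (length xs))) e))) })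
  where
  IH : Alt (not b) (x′ ∷ xs ++ y ∷ []) ⇔ (Alt (not b) (x′ ∷ xs) × (x′ ∷ xs ≡ [] ⊎ flips (not b) (suc (length xs)) ≡ false))
  IH = Alt-∷ʳ-max (not b) (x′ ∷ xs) xs<y
  nonempty : ∀ {P : Set} → (x′ ∷ xs ≡ [] ⊎ P) → P
  nonempty (inj₁ ())
  nonempty (inj₂ p) = p

Alt-max-∷ : ∀ c {y} ys → All (_< y) ys → Alt c (y ∷ ys) ⇔ (ys ≡ [] ⊎ (c ≡ false × AltUp ys))
Alt-max-∷ c     []       _         = mk⇔ (λ _ → inj₁ refl) (λ _ → Alt-[ c ])
Alt-max-∷ true  (z ∷ ys) (z<y ∷ _) = mk⇔ (λ a → ⊥-elim (ℕ.<-asym z<y (proj₁ a))) (λ { (inj₁ ()) ; (inj₂ (() , _)) })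
Alt-max-∷ false (z ∷ ys) (z<y ∷ _) = mk⇔ (λ a → inj₂ (refl , proj₂ a)) (λ { (inj₁ ()) ; (inj₂ (_ , a)) → z<y , a })

isOdd-% : ∀ n → n ℕ.% 2 ≡ (if isOdd n then 1 else 0)
isOdd-% zero          = refl
isOdd-% (suc zero)    = refl
isOdd-% (suc (suc n)) = trans (isOdd-% n) (cong (λ b → if b then 1 else 0) (sym (Bool.not-involutive (isOdd n))))

Odd⇔isOdd : ∀ n → Odd n ⇔ (isOdd n ≡ true)
Odd⇔isOdd n with isOdd n | isOdd-% n
... | true  | e = mk⇔ (λ _ → refl) (λ _ → e)
... | false | e = mk⇔ (λ o → case trans (sym e) o of λ ()) (λ ())

Even⇔isEven : ∀ n → Even n ⇔ (isOdd n ≡ false)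
Even⇔isEven n with isOdd n | isOdd-% n
... | false | e = mk⇔ (λ _ → refl) (λ _ → e)
... | true  | e = mk⇔ (λ o → case trans (sym e) o of λ ()) (λ ())

isOdd-+ : ∀ i j → isOdd (i + j) ≡ isOdd i xor isOdd j
isOdd-+ zero    j = refl
isOdd-+ (suc i) j = trans (cong not (isOdd-+ i j)) (Bool.not-distribˡ-xor (isOdd i) (isOdd j))

map-++⁻ : ∀ (f : ℕ → ℕ) t {xs ys} → map f t ≡ xs ++ ys →
          ∃₂ λ t₁ t₂ → t ≡ t₁ ++ t₂ × map f t₁ ≡ xs × map f t₂ ≡ ys
map-++⁻ f t       {[]}     e = [] , t , refl , refl , e
map-++⁻ f (z ∷ t) {x ∷ xs} e with List.∷-injective e
... | fz≡x , e′ with map-++⁻ f t e′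
...   | t₁ , t₂ , refl , e₁ , e₂ = z ∷ t₁ , t₂ , refl , cong₂ _∷_ fz≡x e₁ , e₂

module OrderEmbedding (f : ℕ → ℕ) (f-mono : ∀ {x y} → x < y → f x < f y)
                      (f-reflects : ∀ {x y} → f x < f y → x < y) where

  Increasing-map : ∀ {t} → Increasing (map f t) ⇔ Increasing t
  Increasing-map = mk⇔ (AllPairs.map f-reflects ∘ AllPairs.map⁻) (AllPairs.map⁺ ∘ AllPairs.map f-mono)

  Has132-map : ∀ {α} → Has132 (map f α) ⇔ Has132 α
  Has132-map {α} = mk⇔ reflect preserve
    where
    reflect : Has132 (map f α) → Has132 α
    reflect (a , b , c , p , a<c , c<b) with ⊆-map⁻ f α p
    ... | a′ ∷ b′ ∷ c′ ∷ [] , q , refl = a′ , b′ , c′ , q , f-reflects a<c , f-reflects c<b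
    preserve : Has132 α → Has132 (map f α)
    preserve (a , b , c , p , a<c , c<b) = f a , f b , f c , Sublistₚ.map⁺ f p , f-mono a<c , f-mono c<b

  HasIncreasing-map : ∀ {L α} → HasIncreasing L (map f α) ⇔ HasIncreasing L α
  HasIncreasing-map {L} {α} = mk⇔ reflect preserve
    where
    reflect : HasIncreasing L (map f α) → HasIncreasing L α
    reflect (s , p , i , l) with ⊆-map⁻ f α p
    ... | t , q , refl = t , q , to Increasing-map i , trans (sym (List.length-map f t)) l
    preserve : HasIncreasing L α → HasIncreasing L (map f α)
    preserve (s , p , i , l) = map f s , Sublistₚ.map⁺ f p , from Increasing-map i , trans (List.length-map f s) l

  HasSigma-map : ∀ {r α} → HasSigma r (map f α) ⇔ HasSigma r α
  HasSigma-map {r} {α} = mk⇔ reflect preserve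
    where
    reflect : HasSigma r (map f α) → HasSigma r α
    reflect (s , c , p , i , a , l) with ⊆-map⁻ f α p
    ... | t , q , e with map-++⁻ f t {s} {c ∷ []} (sym e)
    ...   | t₁ , c′ ∷ [] , refl , refl , refl =
      t₁ , c′ , q , to Increasing-map i , All.map f-reflects (All.map⁻ a) , trans (sym (List.length-map f t₁)) l
    preserve : HasSigma r α → HasSigma r (map f α)
    preserve (s , c , p , i , a , l) =
      map f s , f c , subst (_⊆ _) (List.map-++ f s (c ∷ [])) (Sublistₚ.map⁺ f p) , from Increasing-map i ,
      All.map⁺ (All.map f-mono a) , trans (List.length-map f s) l

  Alt-map : ∀ b {xs} → Alt b (map f xs) ⇔ Alt b xs
  Alt-map b = mk⇔ (reflect b _) (preserve b _)
    where
    Step-reflect : ∀ b {x y} → Step b (f x) (f y) → Step b x y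
    Step-reflect true  = f-reflects
    Step-reflect false = f-reflects
    Step-preserve : ∀ b {x y} → Step b x y → Step b (f x) (f y)
    Step-preserve true  = f-mono
    Step-preserve false = f-mono
    reflect : ∀ b xs → Alt b (map f xs) → Alt b xs
    reflect b []            _ = Alt-[] b
    reflect b (x ∷ [])      _ = Alt-[ b ]
    reflect b (x ∷ x′ ∷ xs) a =
      let s , a′ = to (Alt-∷∷ b) a in from (Alt-∷∷ b) (Step-reflect b s , reflect (not b) (x′ ∷ xs) a′)
    preserve : ∀ b xs → Alt b xs → Alt b (map f xs)
    preserve b []            _ = Alt-[] b
    preserve b (x ∷ [])      _ = Alt-[ b ]
    preserve b (x ∷ x′ ∷ xs) a =
      let s , a′ = to (Alt-∷∷ b) a in from (Alt-∷∷ b) (Step-preserve b s , preserve (not b) (x′ ∷ xs) a′)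

-- Decomposition of 132-avoiders

Above : List ℕ → List ℕ → Set
Above α′ β = All (λ a → All (_< a) β) α′

private
  max∈upper : ∀ {a α′ β m} → (a ∷ α′) ++ β ↭ range (suc m) → Above (a ∷ α′) β → suc m ∈ a ∷ α′
  max∈upper {a} {α′} {β} {m} p β<α with ∈.∈-++⁻ (a ∷ α′) (↭.∈-resp-↭ (↭-sym p) (∈-range⁺ (s≤s z≤n) ℕ.≤-refl))
  ... | inj₁ m∈α = m∈α
  ... | inj₂ m∈β = ⊥-elim (ℕ.<-irrefl refl (ℕ.<-≤-trans (All.lookup (All.lookup β<α (here refl)) m∈β)
                                                       (proj₂ (∈-range⁻ (↭.∈-resp-↭ p (here refl))))))

  Above-remove : ∀ {P Q β x} → Above (P ++ x ∷ Q) β → Above (P ++ Q) β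
  Above-remove {P} β<α = All.++⁺ (All.++⁻ˡ P β<α) (All.drop⁺ 1 (All.++⁻ʳ P β<α))

module MaxSplit {α′ β : List ℕ} {n : ℕ} (α′<n : All (_< n) α′) (β<n : All (_< n) β)
                (β<α′ : Above α′ β) where

  π : List ℕ
  π = α′ ++ n ∷ β

  private
    β<α′∋ : ∀ {a b} → a ∈ α′ → b ∈ β → b < a
    β<α′∋ a∈ b∈ = All.lookup (All.lookup β<α′ a∈) b∈

    ∈n∷β : ∀ {x s} → x ∈ s → s ⊆ n ∷ β → x ≡ n ⊎ x ∈ β
    ∈n∷β x∈         (.n ∷ʳ q) = inj₂ (Sublist.lookup q x∈)
    ∈n∷β (here refl) (refl ∷ q) = inj₁ refl
    ∈n∷β (there x∈)  (refl ∷ q) = inj₂ (Sublist.lookup q x∈)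

    ≤n : ∀ {x s} → x ∈ s → s ⊆ n ∷ β → x ≤ n
    ≤n x∈ q with ∈n∷β x∈ q
    ... | inj₁ refl = ℕ.≤-refl
    ... | inj₂ x∈β = ℕ.<⇒≤ (All.lookup β<n x∈β)

    Increasing-++ˡ : ∀ xs {ys} → Increasing (xs ++ ys) → Increasing xs
    Increasing-++ˡ []       _       = []
    Increasing-++ˡ (x ∷ xs) (a ∷ i) = All.++⁻ˡ xs a ∷ Increasing-++ˡ xs i

    Increasing-++ʳ : ∀ xs {ys} → Increasing (xs ++ ys) → Increasing ys
    Increasing-++ʳ []       i       = i
    Increasing-++ʳ (x ∷ xs) (_ ∷ i) = Increasing-++ʳ xs i

    ++-∷ʳ-split : ∀ (s₁ : List ℕ) {s₂ s c} → s₁ ++ s₂ ≡ s ++ c ∷ [] →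
                  s₂ ≡ [] ⊎ ∃ λ t → s₂ ≡ t ++ c ∷ [] × s ≡ s₁ ++ t
    ++-∷ʳ-split []       {s = s} e = inj₂ (s , e , refl)
    ++-∷ʳ-split (y ∷ s₁) {s = []} e = inj₁ (List.++-conicalʳ s₁ _ (List.∷-injectiveʳ e))
    ++-∷ʳ-split (y ∷ s₁) {s = z ∷ s} e with List.∷-injective e
    ... | refl , e′ with ++-∷ʳ-split s₁ e′
    ...   | inj₁ s₂≡[]          = inj₁ s₂≡[]
    ...   | inj₂ (t , s₂≡ , s≡) = inj₂ (t , s₂≡ , cong (y ∷_) s≡)

    Increasing-∷ʳ-max : ∀ {s} → s ⊆ α′ → Increasing s → Increasing (s ++ n ∷ [])
    Increasing-∷ʳ-max p i = AllPairs.++⁺ i ([] ∷ []) (All.tabulate (λ x∈ → All.lookup α′<n (Sublist.lookup p x∈) ∷ []))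

  Has132⇒ : Has132 π → Has132 α′ ⊎ Has132 β
  Has132⇒ (a , b , c , p , a<c , c<b) with ⊆-split α′ p
  ... | [] , _ , refl , _ , .n ∷ʳ q = inj₂ (a , b , c , q , a<c , c<b)
  ... | [] , _ , refl , _ , refl ∷ q = ⊥-elim (ℕ.<-asym a<c (All.lookup β<n (Sublist.lookup q (there (here refl)))))
  ... | x ∷ [] , _ , refl , p₁ , p₂ with ∈n∷β (there (here refl)) p₂
  ...   | inj₁ refl = ⊥-elim (ℕ.<-irrefl refl (ℕ.<-≤-trans c<b (≤n (here refl) p₂)))
  ...   | inj₂ c∈β = ⊥-elim (ℕ.<-asym a<c (β<α′∋ (Sublist.lookup p₁ (here refl)) c∈β))
  Has132⇒ (a , b , c , p , a<c , c<b) | x ∷ y ∷ [] , _ , refl , p₁ , p₂ with ∈n∷β (here refl) p₂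
  ...   | inj₁ refl = ⊥-elim (ℕ.<-asym c<b (All.lookup α′<n (Sublist.lookup p₁ (there (here refl)))))
  ...   | inj₂ c∈β = ⊥-elim (ℕ.<-asym a<c (β<α′∋ (Sublist.lookup p₁ (here refl)) c∈β))
  Has132⇒ (a , b , c , p , a<c , c<b) | x ∷ y ∷ z ∷ [] , [] , refl , p₁ , _ = inj₁ (a , b , c , p₁ , a<c , c<b)

  Has132⇐ : Has132 α′ ⊎ Has132 β → Has132 π
  Has132⇐ (inj₁ h) = Has132-⊆ (Sublistₚ.++⁺ʳ (n ∷ β) Sublist.⊆-refl) h
  Has132⇐ (inj₂ h) = Has132-⊆ (Sublistₚ.++⁺ˡ α′ (n ∷ʳ Sublist.⊆-refl)) h

  private
    incSplit : ∀ {L} s₁ s₂ → s₁ ⊆ α′ → s₂ ⊆ n ∷ β → Increasing (s₁ ++ s₂) → length (s₁ ++ s₂) ≡ suc L →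
               HasIncreasing (suc L) β ⊎ HasIncreasing L α′
    incSplit [] s₂ _ (.n ∷ʳ q) i l = inj₁ (s₂ , q , i , l)
    incSplit [] (.n ∷ []) _ (refl ∷ q) i refl = inj₂ ([] , Sublist.minimum _ , [] , refl)
    incSplit [] (.n ∷ x ∷ _) _ (refl ∷ q) (a ∷ _) _ =
      ⊥-elim (ℕ.<-asym (All.lookup a (here refl)) (All.lookup β<n (Sublist.lookup q (here refl))))
    incSplit (y ∷ s₁) [] p₁ _ i l rewrite List.++-identityʳ s₁ = inj₂ (HasIncreasing-pred (y ∷ s₁ , p₁ , i , l))
    incSplit (y ∷ s₁) (z ∷ s₂) p₁ (.n ∷ʳ q) (a ∷ _) _ =
      ⊥-elim (ℕ.<-asym (All.lookup a (∈.∈-++⁺ʳ s₁ (here refl)))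
                       (β<α′∋ (Sublist.lookup p₁ (here refl)) (Sublist.lookup q (here refl))))
    incSplit (y ∷ s₁) (.n ∷ []) p₁ (refl ∷ _) i l =
      inj₂ (y ∷ s₁ , p₁ , Increasing-++ˡ (y ∷ s₁) i , ℕ.suc-injective (trans (sym (length-∷ʳ (y ∷ s₁) n)) l))
    incSplit (y ∷ s₁) (.n ∷ w ∷ s₂) _ (refl ∷ q) i _ with Increasing-++ʳ (y ∷ s₁) i
    ... | a ∷ _ = ⊥-elim (ℕ.<-asym (All.lookup a (here refl)) (All.lookup β<n (Sublist.lookup q (here refl))))

  HasIncreasing⇒ : ∀ {L} → HasIncreasing (suc L) π → HasIncreasing (suc L) β ⊎ HasIncreasing L α′
  HasIncreasing⇒ (s , p , i , l) with ⊆-split α′ p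
  ... | s₁ , s₂ , refl , p₁ , p₂ = incSplit s₁ s₂ p₁ p₂ i l

  HasIncreasing⇐ : ∀ {L} → HasIncreasing (suc L) β ⊎ HasIncreasing L α′ → HasIncreasing (suc L) π
  HasIncreasing⇐ (inj₁ h) = HasIncreasing-⊆ (Sublistₚ.++⁺ˡ α′ (n ∷ʳ Sublist.⊆-refl)) h
  HasIncreasing⇐ (inj₂ (s , p , i , l)) =
    s ++ n ∷ [] , Sublistₚ.++⁺ p (refl ∷ Sublist.minimum _) , Increasing-∷ʳ-max p i , trans (length-∷ʳ s n) (cong suc l)

  private
    sigmaSplit : ∀ {r} s₁ t c → s₁ ⊆ α′ → (t ++ c ∷ []) ⊆ n ∷ β → Increasing (s₁ ++ t) →
                 All (c <_) (s₁ ++ t) → length (s₁ ++ t) ≡ suc (suc r) →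
                 HasSigma (suc (suc r)) β ⊎ ((∃ λ x → x ∈ β) × HasIncreasing (suc r) α′)
    sigmaSplit [] (w ∷ t) c _ (.n ∷ʳ q) i a l = inj₁ (w ∷ t , c , q , i , a , l)
    sigmaSplit (y ∷ s₁) [] c p₁ (.n ∷ʳ q) i _ l rewrite List.++-identityʳ s₁ =
      inj₂ ((c , Sublist.lookup q (here refl)) , HasIncreasing-pred (y ∷ s₁ , p₁ , i , l))
    sigmaSplit (y ∷ s₁) (w ∷ t) c p₁ (.n ∷ʳ q) (b ∷ _) _ _ =
      ⊥-elim (ℕ.<-asym (All.lookup b (∈.∈-++⁺ʳ s₁ (here refl)))
                       (β<α′∋ (Sublist.lookup p₁ (here refl)) (Sublist.lookup q (here refl))))
    sigmaSplit (y ∷ s₁) [] .n p₁ (refl ∷ _) _ (b ∷ _) _ =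
      ⊥-elim (ℕ.<-asym b (All.lookup α′<n (Sublist.lookup p₁ (here refl))))
    sigmaSplit s₁ (.n ∷ []) c p₁ (refl ∷ q) i _ l =
      inj₂ ((c , Sublist.lookup q (here refl)) ,
            (s₁ , p₁ , Increasing-++ˡ s₁ i , ℕ.suc-injective (trans (sym (length-∷ʳ s₁ n)) l)))
    sigmaSplit s₁ (.n ∷ w ∷ t) c _ (refl ∷ q) i _ _ with Increasing-++ʳ s₁ i
    ... | b ∷ _ = ⊥-elim (ℕ.<-asym (All.lookup b (here refl)) (All.lookup β<n (Sublist.lookup q (here refl))))

  HasSigma⇒ : ∀ {r} → HasSigma (suc (suc r)) π →
              HasSigma (suc (suc r)) α′ ⊎ HasSigma (suc (suc r)) β ⊎ ((∃ λ x → x ∈ β) × HasIncreasing (suc r) α′)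
  HasSigma⇒ (s , c , p , i , a , l) with ⊆-split α′ p
  ... | s₁ , s₂ , e , p₁ , p₂ with ++-∷ʳ-split s₁ e
  ...   | inj₁ refl = inj₁ (s , c , subst (_⊆ α′) (trans (sym (List.++-identityʳ s₁)) e) p₁ , i , a , l)
  ...   | inj₂ (t , refl , refl) = inj₂ (sigmaSplit s₁ t c p₁ p₂ i a l)

  HasSigma⇐ : ∀ {r} → HasSigma (suc (suc r)) α′ ⊎ HasSigma (suc (suc r)) β ⊎ ((∃ λ x → x ∈ β) × HasIncreasing (suc r) α′) →
              HasSigma (suc (suc r)) π
  HasSigma⇐ (inj₁ h) = HasSigma-⊆ (Sublistₚ.++⁺ʳ (n ∷ β) Sublist.⊆-refl) h
  HasSigma⇐ (inj₂ (inj₁ h)) = HasSigma-⊆ (Sublistₚ.++⁺ˡ α′ (n ∷ʳ Sublist.⊆-refl)) h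
  HasSigma⇐ (inj₂ (inj₂ ((c , c∈β) , (s , p , i , l)))) =
    s ++ n ∷ [] , c ,
    subst (_⊆ π) (sym (List.++-assoc s (n ∷ []) (c ∷ []))) (Sublistₚ.++⁺ p (refl ∷ Sublist.from∈ c∈β)) ,
    Increasing-∷ʳ-max p i ,
    All.++⁺ (All.tabulate (λ x∈ → β<α′∋ (Sublist.lookup p x∈) c∈β)) (All.lookup β<n c∈β ∷ []) ,
    trans (length-∷ʳ s n) (cong suc l)

132-avoider-separated : ∀ {α′ β n} → All (_< n) β → (∀ {x} → x ∈ α′ → x ∉ β) → ¬ Has132 (α′ ++ n ∷ β) →
                        Above α′ β
132-avoider-separated {α′} {β} {n} β<n disjoint ¬132 = All.tabulate λ a∈ → All.tabulate λ b∈ → below a∈ b∈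
  where
  below : ∀ {a b} → a ∈ α′ → b ∈ β → b < a
  below {a} {b} a∈ b∈ with ℕ.<-cmp b a
  ... | tri< b<a _ _ = b<a
  ... | tri≈ _ refl _ = ⊥-elim (disjoint a∈ b∈)
  ... | tri> _ _ a<b = ⊥-elim (¬132 (a , n , b , Sublistₚ.++⁺ (Sublist.from∈ a∈) (refl ∷ Sublist.from∈ b∈) ,
                                     a<b , All.lookup β<n b∈))

separated-↭-range : ∀ α′ β m → α′ ++ β ↭ range m → Above α′ β →
                    β ↭ range (length β) × α′ ↭ map (_+ length β) (range (length α′))
separated-↭-range []       β m       p _ = subst (λ n → β ↭ range n) (sym (IsPerm-length p)) p , ↭.refl
separated-↭-range (a ∷ α′) β zero    p _ with ↭.↭-length p
... | ()
separated-↭-range (a ∷ α′) β (suc m) p β<α with ∈.∈-∃++ (max∈upper p β<α)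
... | P , Q , α≡ = proj₁ IH , subst (λ α → α ↭ map (_+ length β) (range (length α))) (sym α≡) upper
  where
  rest↭ : (P ++ Q) ++ β ↭ range m
  rest↭ = subst₂ _↭_ (sym (List.++-assoc P Q β)) (List.++-identityʳ (range m))
            (↭.drop-mid P (range m)
              (subst₂ _↭_ (trans (cong (_++ β) α≡) (List.++-assoc P _ β)) (range-suc m) p))
  L : ℕ
  L = length (P ++ Q)
  IH : β ↭ range (length β) × P ++ Q ↭ map (_+ length β) (range L)
  IH = separated-↭-range (P ++ Q) β m rest↭ (Above-remove {P} (subst (λ α → Above α β) α≡ β<α))
  length-P++m∷Q : length (P ++ suc m ∷ Q) ≡ suc L
  length-P++m∷Q = trans (List.length-++ P) (trans (ℕ.+-suc (length P) (length Q)) (cong suc (sym (List.length-++ P))))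
  m≡ : suc m ≡ suc L + length β
  m≡ = trans (sym (IsPerm-length p)) (trans (List.length-++ (a ∷ α′)) (cong (λ l → l + length β) (trans (cong length α≡) length-P++m∷Q)))
  upper : P ++ suc m ∷ Q ↭ map (_+ length β) (range (length (P ++ suc m ∷ Q)))
  upper = begin
    P ++ suc m ∷ Q                                      ↭⟨ ↭.shift (suc m) P Q ⟩
    suc m ∷ P ++ Q                                      ↭⟨ ↭.∷↭∷ʳ (suc m) (P ++ Q) ⟩
    (P ++ Q) ++ suc m ∷ []                              ↭⟨ ↭.++⁺ʳ (suc m ∷ []) (proj₂ IH) ⟩
    map (_+ length β) (range L) ++ suc m ∷ []           ≡⟨ cong (λ k → map (_+ length β) (range L) ++ k ∷ []) m≡ ⟩
    map (_+ length β) (range L) ++ suc L + length β ∷ [] ≡⟨ List.map-++ (_+ length β) (range L) (suc L ∷ []) ⟨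
    map (_+ length β) (range L ++ suc L ∷ [])          ≡⟨ cong (map (_+ length β)) (range-suc L) ⟨
    map (_+ length β) (range (suc L))                   ≡⟨ cong (map (_+ length β) ∘ range) length-P++m∷Q ⟨
    map (_+ length β) (range (length (P ++ suc m ∷ Q))) ∎
    where open ↭.PermutationReasoning

map-id-on : ∀ (g : ℕ → ℕ) xs → All (λ x → g x ≡ x) xs → map g xs ≡ xs
map-id-on g []       []       = refl
map-id-on g (x ∷ xs) (e ∷ es) = cong₂ _∷_ e (map-id-on g xs es)

132-avoider-glue : ∀ m π → IsPerm (suc m) π → ¬ Has132 π →
  ∃₂ λ α β → π ≡ glue α β × IsPerm (length α) α × IsPerm (length β) β × length α + length β ≡ m
132-avoider-glue m π p ¬132 with ∈.∈-∃++ (↭.∈-resp-↭ (↭-sym p) (∈-range⁺ {suc m} (s≤s z≤n) ℕ.≤-refl))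
... | α′ , β , π≡ = map (_∸ length β) α′ , β , π-glue , α-perm , proj₁ parts , lengths
  where
  rest↭ : α′ ++ β ↭ range m
  rest↭ = subst (α′ ++ β ↭_) (List.++-identityʳ (range m))
            (↭.drop-mid α′ (range m) (subst₂ _↭_ π≡ (range-suc m) p))
  β<m : All (_< suc m) β
  β<m = All.tabulate λ x∈ → s≤s (proj₂ (∈-range⁻ (↭.∈-resp-↭ rest↭ (∈.∈-++⁺ʳ α′ x∈))))
  β<α′ : Above α′ β
  β<α′ = 132-avoider-separated β<m
           (Unique-++⇒disjoint α′ (Unique-resp-↭ (↭-sym rest↭) (Unique-range m)))
           (¬132 ∘ subst Has132 (sym π≡))
  j : ℕ
  j = length β
  parts : β ↭ range j × α′ ↭ map (_+ j) (range (length α′))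
  parts = separated-↭-range α′ β m rest↭ β<α′
  raise-lower : map (_+ j) (map (_∸ j) α′) ≡ α′
  raise-lower = trans (sym (List.map-∘ α′)) (map-id-on _ α′ (All.tabulate λ x∈ → lower-raise (∈.∈-map⁻ (_+ j) (↭.∈-resp-↭ (proj₂ parts) x∈))))
    where
    lower-raise : ∀ {x} → ∃ (λ y → y ∈ range (length α′) × x ≡ y + j) → x ∸ j + j ≡ x
    lower-raise (y , _ , refl) = cong (_+ j) (ℕ.m+n∸n≡m y j)
  length-α : length (map (_∸ j) α′) ≡ length α′
  length-α = List.length-map (_∸ j) α′
  α-perm : IsPerm (length (map (_∸ j) α′)) (map (_∸ j) α′)
  α-perm = subst (λ n → map (_∸ j) α′ ↭ range n) (sym length-α)
    (subst (map (_∸ j) α′ ↭_)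
           (trans (sym (List.map-∘ (range (length α′)))) (map-id-on _ _ (All.tabulate λ {x} _ → ℕ.m+n∸n≡m x j)))
           (↭.map⁺ (_∸ j) (proj₂ parts)))
  lengths : length (map (_∸ j) α′) + j ≡ m
  lengths = trans (cong (_+ j) length-α) (trans (sym (List.length-++ α′)) (IsPerm-length rest↭))
  π-glue : π ≡ glue (map (_∸ j) α′) β
  π-glue = trans π≡ (cong₂ (λ u v → u ++ v ∷ β) (sym raise-lower) (cong suc (sym lengths)))

glue-IsPerm : ∀ {i j α β} → IsPerm i α → IsPerm j β → IsPerm (suc (i + j)) (glue α β)
glue-IsPerm {i} {j} {α} {β} pα pβ =
  subst₂ (λ u v → map (_+ v) α ++ suc (u + v) ∷ β ↭ range (suc (i + j))) (sym (IsPerm-length pα)) (sym (IsPerm-length pβ))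
    (begin
      map (_+ j) α ++ n ∷ β                  ↭⟨ ↭.shift n (map (_+ j) α) β ⟩
      n ∷ map (_+ j) α ++ β                  ↭⟨ ↭.prep n (↭.++-comm (map (_+ j) α) β) ⟩
      n ∷ β ++ map (_+ j) α                  ↭⟨ ↭.prep n (↭.++⁺ pβ (↭.map⁺ (_+ j) pα)) ⟩
      n ∷ range j ++ map (_+ j) (range i)    ↭⟨ ↭.∷↭∷ʳ n (range j ++ map (_+ j) (range i)) ⟩
      (range j ++ map (_+ j) (range i)) ++ n ∷ [] ≡⟨ cong (_++ n ∷ []) (range-+ i j) ⟨
      range (i + j) ++ n ∷ []                ≡⟨ range-suc (i + j) ⟨
      range n                                ∎)
  where
  n = suc (i + j)
  open ↭.PermutationReasoning

glue-bounds : ∀ {α β} → IsPerm (length α) α → IsPerm (length β) β →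
  All (_< suc (length α + length β)) (map (_+ length β) α) × All (_< suc (length α + length β)) β ×
  Above (map (_+ length β) α) β
glue-bounds {α} {β} pα pβ =
  All.map⁺ (All.tabulate λ x∈ → s≤s (ℕ.+-monoˡ-≤ (length β) (proj₂ (IsPerm-bounds pα x∈)))) ,
  All.tabulate (λ y∈ → s≤s (ℕ.≤-trans (proj₂ (IsPerm-bounds pβ y∈)) (ℕ.m≤n+m (length β) (length α)))) ,
  All.map⁺ (All.tabulate λ x∈ → All.tabulate λ y∈ →
    ℕ.≤-trans (s≤s (proj₂ (IsPerm-bounds pβ y∈))) (ℕ.+-monoˡ-≤ (length β) (proj₁ (IsPerm-bounds pα x∈))))

module GlueFacts {α β : List ℕ} (pα : IsPerm (length α) α) (pβ : IsPerm (length β) β) where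

  private
    j n : ℕ
    j = length β
    n = suc (length α + j)
    α′ : List ℕ
    α′ = map (_+ j) α
    α′<n : All (_< n) α′
    α′<n = proj₁ (glue-bounds pα pβ)
    β<n : All (_< n) β
    β<n = proj₁ (proj₂ (glue-bounds pα pβ))
    open MaxSplit α′<n β<n (proj₂ (proj₂ (glue-bounds pα pβ)))
    open OrderEmbedding (_+ j) (ℕ.+-monoˡ-< j) (ℕ.+-cancelʳ-< _ _ _)

  ¬Has132-glue : (¬ Has132 (glue α β)) ⇔ ((¬ Has132 α) × (¬ Has132 β))
  ¬Has132-glue = mk⇔ (λ ¬h → ¬h ∘ Has132⇐ ∘ inj₁ ∘ from Has132-map , ¬h ∘ Has132⇐ ∘ inj₂)
                     (λ (¬a , ¬b) → [ ¬a ∘ to Has132-map , ¬b ]′ ∘ Has132⇒)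

  HasIncreasing-glue : ∀ L → HasIncreasing (suc L) (glue α β) ⇔ (HasIncreasing (suc L) β ⊎ HasIncreasing L α)
  HasIncreasing-glue L = mk⇔ (Sum.map₂ (to HasIncreasing-map) ∘ HasIncreasing⇒)
                             (HasIncreasing⇐ ∘ Sum.map₂ (from HasIncreasing-map))

  HasSigma-glue : ∀ r → HasSigma (suc (suc r)) (glue α β) ⇔
                  (HasSigma (suc (suc r)) α ⊎ HasSigma (suc (suc r)) β ⊎ ((∃ λ x → x ∈ β) × HasIncreasing (suc r) α))
  HasSigma-glue r = mk⇔ (Sum.map (to HasSigma-map) (Sum.map₂ (Product.map₂ (to HasIncreasing-map))) ∘ HasSigma⇒)
                        (HasSigma⇐ ∘ Sum.map (from HasSigma-map) (Sum.map₂ (Product.map₂ (from HasIncreasing-map))))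

  private
    flips-α′ : ∀ b → flips b (length α′) ≡ flips b (length α)
    flips-α′ b = cong (flips b) (List.length-map (_+ j) α)

    AltUp-∅ : ∀ {xs} → xs ≡ [] → AltUp xs
    AltUp-∅ refl = tt

    up-after-max : ∀ {c} → (β ≡ [] ⊎ (c ≡ false × AltUp β)) → AltUp β
    up-after-max = [ AltUp-∅ , proj₂ ]′

    odd-peak : flips true (length α) ≡ false → isOdd (length α) ≡ true
    odd-peak e = trans (sym (Bool.not-involutive _)) (cong not (trans (sym (flips-not false (length α))) e))

    peak-odd : isOdd (length α) ≡ true → flips true (length α′) ≡ false
    peak-odd e = trans (flips-α′ true) (trans (flips-not false (length α)) (cong not e))

  AltUp-glue : AltUp (glue α β) ⇔ (AltUp α × AltUp β × ((α ≡ [] × β ≡ []) ⊎ isOdd (length α) ≡ true))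
  AltUp-glue = mk⇔ forward backward
    where
    forward : AltUp (glue α β) → AltUp α × AltUp β × ((α ≡ [] × β ≡ []) ⊎ isOdd (length α) ≡ true)
    forward a =
      let a₁ , a₂ = to (Alt-++-∷ true α′ n β) a
          u , c₁ = to (Alt-∷ʳ-max true α′ α′<n) a₁
          c₂ = to (Alt-max-∷ (flips true (length α′)) β β<n) a₂
      in to (Alt-map true) u , up-after-max c₂ , peak c₁ c₂
      where
      peak : ∀ {c} → (α′ ≡ [] ⊎ flips true (length α′) ≡ false) → (β ≡ [] ⊎ (flips true (length α′) ≡ false × c)) →
             (α ≡ [] × β ≡ []) ⊎ isOdd (length α) ≡ true
      peak (inj₂ e)        _                = inj₂ (odd-peak (trans (sym (flips-α′ true)) e))
      peak (inj₁ _)        (inj₂ (e , _))   = inj₂ (odd-peak (trans (sym (flips-α′ true)) e))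
      peak (inj₁ α′≡[])    (inj₁ β≡[])      = inj₁ (List.map-injective (ℕ.+-cancelʳ-≡ _ _ _) α′≡[] , β≡[])
    backward : AltUp α × AltUp β × ((α ≡ [] × β ≡ []) ⊎ isOdd (length α) ≡ true) → AltUp (glue α β)
    backward (_ , _ , inj₁ (refl , refl)) = tt
    backward (u , b , inj₂ odd) =
      from (Alt-++-∷ true α′ n β)
        (from (Alt-∷ʳ-max true α′ α′<n) (from (Alt-map true) u , inj₂ (peak-odd odd)) ,
         from (Alt-max-∷ (flips true (length α′)) β β<n) (inj₂ (peak-odd odd , b)))

  AltDown-glue : AltDown (glue α β) ⇔ (AltDown α × AltUp β × isOdd (length α) ≡ false)
  AltDown-glue = mk⇔ forward backward
    where
    forward : AltDown (glue α β) → AltDown α × AltUp β × isOdd (length α) ≡ false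
    forward a =
      let a₁ , a₂ = to (Alt-++-∷ false α′ n β) a
          u , c₁ = to (Alt-∷ʳ-max false α′ α′<n) a₁
      in to (Alt-map false) u , up-after-max (to (Alt-max-∷ (isOdd (length α′)) β β<n) a₂) ,
         trans (sym (flips-α′ false)) ([ cong (isOdd ∘ length) , id ]′ c₁)
    backward : AltDown α × AltUp β × isOdd (length α) ≡ false → AltDown (glue α β)
    backward (u , b , even) =
      from (Alt-++-∷ false α′ n β)
        (from (Alt-∷ʳ-max false α′ α′<n) (from (Alt-map false) u , inj₂ (trans (flips-α′ false) even)) ,
         from (Alt-max-∷ (isOdd (length α′)) β β<n) (inj₂ (trans (flips-α′ false) even , b)))

  ¬HasIncreasing-glue : ∀ h → (¬ HasIncreasing (suc h) (glue α β)) ⇔ ((¬ HasIncreasing h α) × (¬ HasIncreasing (suc h) β))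
  ¬HasIncreasing-glue h = mk⇔ (λ ¬h → ¬h ∘ from (HasIncreasing-glue h) ∘ inj₂ , ¬h ∘ from (HasIncreasing-glue h) ∘ inj₁)
                              (λ (¬iα , ¬iβ) → [ ¬iβ , ¬iα ]′ ∘ to (HasIncreasing-glue h))

  ¬HasSigma-glue : ∀ r → (∃ λ x → x ∈ β) →
    (¬ HasSigma (suc (suc r)) (glue α β)) ⇔ ((¬ HasIncreasing (suc r) α) × (¬ HasSigma (suc (suc r)) β))
  ¬HasSigma-glue r x∈β = mk⇔
    (λ ¬h → (λ i → ¬h (from (HasSigma-glue r) (inj₂ (inj₂ (x∈β , i))))) , ¬h ∘ from (HasSigma-glue r) ∘ inj₂ ∘ inj₁)
    (λ (¬iα , ¬sβ) → [ ¬iα ∘ HasIncreasing-pred ∘ HasSigma⇒HasIncreasing , [ ¬sβ , ¬iα ∘ proj₂ ]′ ]′ ∘ to (HasSigma-glue r))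

  ¬HasSigma-glue-[] : ∀ r → β ≡ [] → (¬ HasSigma (suc (suc r)) (glue α β)) ⇔ (¬ HasSigma (suc (suc r)) α)
  ¬HasSigma-glue-[] r refl = mk⇔ (λ ¬h → ¬h ∘ from (HasSigma-glue r) ∘ inj₁)
    (λ ¬sα → [ ¬sα , [ ¬HasSigma-short z≤n , (λ { ((_ , ()) , _) }) ]′ ]′ ∘ to (HasSigma-glue r))

isOdd-glue-oddˡ : ∀ i j → isOdd i ≡ true → isOdd (suc (i + j)) ≡ isOdd j
isOdd-glue-oddˡ i j e = trans (cong not (trans (isOdd-+ i j) (cong (_xor isOdd j) e))) (Bool.not-involutive (isOdd j))

isOdd-glue-evenˡ : ∀ i j → isOdd i ≡ false → isOdd (suc (i + j)) ≡ not (isOdd j)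
isOdd-glue-evenˡ i j e = cong not (trans (isOdd-+ i j) (cong (_xor isOdd j) e))

not-swap : ∀ {b c} → not b ≡ c → b ≡ not c
not-swap {b} e = trans (sym (Bool.not-involutive b)) (cong not e)

Up-glue : ∀ {α β p} → IsPerm (length α) α → IsPerm (length β) β →
  (isOdd (suc (length α + length β)) ≡ p × AltUp (glue α β)) ⇔
  ((α ≡ [] × β ≡ [] × p ≡ true) ⊎ (isOdd (length α) ≡ true × AltUp α × isOdd (length β) ≡ p × AltUp β))
Up-glue {α} {β} {p} pα pβ = mk⇔ forward backward
  where
  open GlueFacts pα pβ
  forward : isOdd (suc (length α + length β)) ≡ p × AltUp (glue α β) →
            (α ≡ [] × β ≡ [] × p ≡ true) ⊎ (isOdd (length α) ≡ true × AltUp α × isOdd (length β) ≡ p × AltUp β)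
  forward (odd , up) with to AltUp-glue up
  ... | _  , _  , inj₁ (refl , refl) = inj₁ (refl , refl , sym odd)
  ... | uα , uβ , inj₂ oddα = inj₂ (oddα , uα , trans (sym (isOdd-glue-oddˡ (length α) (length β) oddα)) odd , uβ)
  backward : (α ≡ [] × β ≡ [] × p ≡ true) ⊎ (isOdd (length α) ≡ true × AltUp α × isOdd (length β) ≡ p × AltUp β) →
             isOdd (suc (length α + length β)) ≡ p × AltUp (glue α β)
  backward (inj₁ (refl , refl , refl)) = refl , tt
  backward (inj₂ (oddα , uα , oddβ , uβ)) =
    trans (isOdd-glue-oddˡ (length α) (length β) oddα) oddβ , from AltUp-glue (uα , uβ , inj₂ oddα)

Down-glue : ∀ {α β p} → IsPerm (length α) α → IsPerm (length β) β →
  (isOdd (suc (length α + length β)) ≡ p × AltDown (glue α β)) ⇔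
  (isOdd (length α) ≡ false × AltDown α × isOdd (length β) ≡ not p × AltUp β)
Down-glue {α} {β} {p} pα pβ = mk⇔ forward backward
  where
  open GlueFacts pα pβ
  forward : isOdd (suc (length α + length β)) ≡ p × AltDown (glue α β) →
            isOdd (length α) ≡ false × AltDown α × isOdd (length β) ≡ not p × AltUp β
  forward (odd , down) with to AltDown-glue down
  ... | dα , uβ , evenα = evenα , dα , not-swap (trans (sym (isOdd-glue-evenˡ (length α) (length β) evenα)) odd) , uβ
  backward : isOdd (length α) ≡ false × AltDown α × isOdd (length β) ≡ not p × AltUp β →
             isOdd (suc (length α + length β)) ≡ p × AltDown (glue α β)
  backward (evenα , dα , oddβ , uβ) =
    trans (isOdd-glue-evenˡ (length α) (length β) evenα) (sym (not-swap (sym oddβ))) , from AltDown-glue (dα , uβ , evenα)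

GlueClass-intro : ∀ {P Q : ℕ → Class} {m α β} → P (length α) α → Q (length β) β → length α + length β ≡ m →
                  GlueClass P Q m (glue α β)
GlueClass-intro {Q = Q} {m} {α} {β} Pα Qβ ls =
  length α , s≤s (subst (length α ≤_) ls (ℕ.m≤m+n _ _)) , α , β , Pα ,
  subst (λ k → Q k β) (sym (trans (cong (_∸ length α) (sym ls)) (ℕ.m+n∸m≡n (length α) (length β)))) Qβ , refl

GlueClass-elim : ∀ {P Q : ℕ → Class} {m π} → PermFamily P → PermFamily Q → GlueClass P Q m π →
  ∃₂ λ α β → π ≡ glue α β × P (length α) α × Q (length β) β × length α + length β ≡ m
GlueClass-elim {P} {Q} {m} permP permQ (i , i<sm , α , β , Pα , Qβ , π≡) =
  α , β , π≡ , subst (λ k → P k α) (sym lα) Pα , subst (λ k → Q k β) (sym lβ) Qβ ,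
  trans (cong₂ _+_ lα lβ) (ℕ.m+[n∸m]≡n (ℕ.≤-pred i<sm))
  where
  lα : length α ≡ i
  lα = IsPerm-length (permP Pα)
  lβ : length β ≡ m ∸ i
  lβ = IsPerm-length (permQ Qβ)

-- d is the direction of the first step (true: up) and p the parity of the length (true: odd)
Alternating : Bool → Bool → (List ℕ → Set) → ℕ → Class
Alternating d p F n π = IsPerm n π × (isOdd n ≡ p × Alt d π) × ¬ Has132 π × ¬ F π

GlueView : Bool → Bool → (List ℕ → Set) → ℕ → Class
GlueView d p F m π =
  ∃₂ λ α β → π ≡ glue α β × length α + length β ≡ m × IsPerm (length α) α × IsPerm (length β) β ×
             (isOdd (suc (length α + length β)) ≡ p × Alt d (glue α β)) × ¬ Has132 α × ¬ Has132 β × ¬ F (glue α β)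

Alternating-glue : ∀ {d p F m π} → Alternating d p F (suc m) π ⇔ GlueView d p F m π
Alternating-glue {d} {p} {F} {m} {π} = mk⇔ forward backward
  where
  forward : Alternating d p F (suc m) π → GlueView d p F m π
  forward (pπ , alt , ¬132 , ¬F) with 132-avoider-glue m π pπ ¬132
  ... | α , β , refl , pα , pβ , ls =
    let ¬132α , ¬132β = to (GlueFacts.¬Has132-glue pα pβ) ¬132
    in α , β , refl , ls , pα , pβ , subst (λ k → isOdd (suc k) ≡ p × Alt d (glue α β)) (sym ls) alt ,
       ¬132α , ¬132β , ¬F
  backward : GlueView d p F m π → Alternating d p F (suc m) π
  backward (α , β , refl , ls , pα , pβ , alt , ¬132α , ¬132β , ¬F) =
    subst (λ k → IsPerm (suc k) (glue α β)) ls (glue-IsPerm pα pβ) ,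
    subst (λ k → isOdd (suc k) ≡ p × Alt d (glue α β)) ls alt ,
    from (GlueFacts.¬Has132-glue pα pβ) (¬132α , ¬132β) , ¬F

Singleton : ℕ → Class
Singleton m π = m ≡ 0 × π ≡ 1 ∷ []

Alternating-[1] : ∀ F → ¬ F (1 ∷ []) → Alternating true true F 1 (1 ∷ [])
Alternating-[1] _ ¬F = ↭.refl , (refl , tt) , ¬Has132-short (s≤s (s≤s z≤n)) , ¬F

UDInc DDInc : ℕ → ℕ → Class
UDInc h = Alternating true  true  (HasIncreasing (suc h))
DDInc h = Alternating false false (HasIncreasing (suc h))

UDInc-rec : ∀ h m π → UDInc (suc h) (suc m) π ⇔ (Singleton m ∪ GlueClass (UDInc h) (UDInc (suc h)) m) π
UDInc-rec h m π = mk⇔ (forward ∘ to view) backward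
  where
  view : ∀ {π} → UDInc (suc h) (suc m) π ⇔ GlueView true true (HasIncreasing (suc (suc h))) m π
  view = Alternating-glue {true} {true} {HasIncreasing (suc (suc h))}
  forward : ∀ {π} → GlueView true true (HasIncreasing (suc (suc h))) m π →
            (Singleton m ∪ GlueClass (UDInc h) (UDInc (suc h)) m) π
  forward (α , β , refl , ls , pα , pβ , alt , ¬132α , ¬132β , ¬inc) with to (Up-glue pα pβ) alt
  ... | inj₁ (refl , refl , _) = inj₁ (sym ls , refl)
  ... | inj₂ (oα , uα , oβ , uβ) =
    let ¬incα , ¬incβ = to (GlueFacts.¬HasIncreasing-glue pα pβ (suc h)) ¬inc
    in inj₂ (GlueClass-intro {UDInc h} {UDInc (suc h)} (pα , (oα , uα) , ¬132α , ¬incα) (pβ , (oβ , uβ) , ¬132β , ¬incβ) ls)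
  backward : ∀ {π} → (Singleton m ∪ GlueClass (UDInc h) (UDInc (suc h)) m) π → UDInc (suc h) (suc m) π
  backward (inj₁ (refl , refl)) = Alternating-[1] (HasIncreasing (suc (suc h))) (¬HasIncreasing-short (s≤s (s≤s z≤n)))
  backward (inj₂ g) with GlueClass-elim {UDInc h} {UDInc (suc h)} proj₁ proj₁ g
  ... | α , β , refl , (pα , (oα , uα) , ¬132α , ¬incα) , (pβ , (oβ , uβ) , ¬132β , ¬incβ) , ls =
    from view (α , β , refl , ls , pα , pβ , from (Up-glue pα pβ) (inj₂ (oα , uα , oβ , uβ)) ,
                           ¬132α , ¬132β , from (GlueFacts.¬HasIncreasing-glue pα pβ (suc h)) (¬incα , ¬incβ))

DDInc-rec : ∀ h m π → DDInc (suc h) (suc m) π ⇔ GlueClass (DDInc h) (UDInc (suc h)) m π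
DDInc-rec h m π = mk⇔ (forward ∘ to view) backward
  where
  view : ∀ {π} → DDInc (suc h) (suc m) π ⇔ GlueView false false (HasIncreasing (suc (suc h))) m π
  view = Alternating-glue {false} {false} {HasIncreasing (suc (suc h))}
  forward : ∀ {π} → GlueView false false (HasIncreasing (suc (suc h))) m π → GlueClass (DDInc h) (UDInc (suc h)) m π
  forward (α , β , refl , ls , pα , pβ , alt , ¬132α , ¬132β , ¬inc) =
    let eα , dα , oβ , uβ = to (Down-glue pα pβ) alt
        ¬incα , ¬incβ = to (GlueFacts.¬HasIncreasing-glue pα pβ (suc h)) ¬inc
    in GlueClass-intro {DDInc h} {UDInc (suc h)} (pα , (eα , dα) , ¬132α , ¬incα) (pβ , (oβ , uβ) , ¬132β , ¬incβ) ls
  backward : ∀ {π} → GlueClass (DDInc h) (UDInc (suc h)) m π → DDInc (suc h) (suc m) π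
  backward g with GlueClass-elim {DDInc h} {UDInc (suc h)} proj₁ proj₁ g
  ... | α , β , refl , (pα , (eα , dα) , ¬132α , ¬incα) , (pβ , (oβ , uβ) , ¬132β , ¬incβ) , ls =
    from view (α , β , refl , ls , pα , pβ , from (Down-glue pα pβ) (eα , dα , oβ , uβ) ,
                           ¬132α , ¬132β , from (GlueFacts.¬HasIncreasing-glue pα pβ (suc h)) (¬incα , ¬incβ))

nonempty : ∀ {β : List ℕ} → 1 ≤ length β → ∃ λ x → x ∈ β
nonempty {x ∷ _} _ = x , here refl

isOdd⇒1≤ : ∀ {n} → isOdd n ≡ true → 1 ≤ n
isOdd⇒1≤ {suc n} _ = s≤s z≤n

module Avoiding (r′ : ℕ) where

  σ : List ℕ → Set
  σ = HasSigma (suc (suc r′))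

  UDσ : ℕ → Class
  UDσ = Alternating true true σ

  AtLeast : ℕ → (ℕ → Class) → ℕ → Class
  AtLeast k C n π = k ≤ n × C n π

  UD UU DD DU : ℕ → Class
  UD = AtLeast 2 UDσ
  UU = AtLeast 1 (Alternating true false σ)
  DD = AtLeast 1 (Alternating false false σ)
  DU = AtLeast 2 (Alternating false true σ)

  UDσ-rec : ∀ m π → UDσ (suc m) π ⇔ (Singleton m ∪ GlueClass (UDInc r′) UDσ m) π
  UDσ-rec m π = mk⇔ (forward ∘ to view) backward
    where
    view : ∀ {π} → UDσ (suc m) π ⇔ GlueView true true σ m π
    view = Alternating-glue {true} {true} {σ}
    forward : ∀ {π} → GlueView true true σ m π → (Singleton m ∪ GlueClass (UDInc r′) UDσ m) π
    forward (α , β , refl , ls , pα , pβ , alt , ¬132α , ¬132β , ¬σ) with to (Up-glue pα pβ) alt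
    ... | inj₁ (refl , refl , _) = inj₁ (sym ls , refl)
    ... | inj₂ (oα , uα , oβ , uβ) =
      let ¬incα , ¬σβ = to (GlueFacts.¬HasSigma-glue pα pβ r′ (nonempty (isOdd⇒1≤ oβ))) ¬σ
      in inj₂ (GlueClass-intro {UDInc r′} {UDσ} (pα , (oα , uα) , ¬132α , ¬incα) (pβ , (oβ , uβ) , ¬132β , ¬σβ) ls)
    backward : ∀ {π} → (Singleton m ∪ GlueClass (UDInc r′) UDσ m) π → UDσ (suc m) π
    backward (inj₁ (refl , refl)) = Alternating-[1] σ (¬HasSigma-short (s≤s z≤n))
    backward (inj₂ g) with GlueClass-elim {UDInc r′} {UDσ} proj₁ proj₁ g
    ... | α , β , refl , (pα , (oα , uα) , ¬132α , ¬incα) , (pβ , (oβ , uβ) , ¬132β , ¬σβ) , ls =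
      from view (α , β , refl , ls , pα , pβ , from (Up-glue pα pβ) (inj₂ (oα , uα , oβ , uβ)) , ¬132α , ¬132β ,
                 from (GlueFacts.¬HasSigma-glue pα pβ r′ (nonempty (isOdd⇒1≤ oβ))) (¬incα , ¬σβ))

  UD-rec : ∀ m π → UD (suc m) π ⇔ GlueClass (UDInc r′) UDσ m π
  UD-rec m π = mk⇔ forward backward
    where
    forward : UD (suc m) π → GlueClass (UDInc r′) UDσ m π
    forward (2≤ , q) with to (UDσ-rec m π) q
    ... | inj₁ (refl , _) with 2≤
    ...   | s≤s ()
    forward (2≤ , q) | inj₂ g = g
    backward : GlueClass (UDInc r′) UDσ m π → UD (suc m) π
    backward g@(i , _ , _ , _ , _ , (_ , (oβ , _) , _) , _) =
      s≤s (ℕ.≤-trans (isOdd⇒1≤ oβ) (ℕ.m∸n≤m m i)) , from (UDσ-rec m π) (inj₂ g)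

  private
    glue-[]-view : ∀ {d p m α} → IsPerm m α → (isOdd (suc (length α + 0)) ≡ p × Alt d (glue α [])) →
                   ¬ Has132 α → ¬ σ α → GlueView d p σ m (glue α [])
    glue-[]-view {m = m} {α} pα alt ¬132α ¬σα =
      α , [] , refl , trans (ℕ.+-identityʳ _) (IsPerm-length pα) , IsPerm-self pα , ↭.refl , alt ,
      ¬132α , ¬Has132-short (s≤s z≤n) , from (GlueFacts.¬HasSigma-glue-[] (IsPerm-self pα) ↭.refl r′ refl) ¬σα

  UU-rec : ∀ m π → UU (suc m) π ⇔ (GlueWithMax UDσ m ∪ GlueClass (UDInc r′) UU m) π
  UU-rec m π = mk⇔ (forward ∘ to view ∘ proj₂) backward
    where
    view : ∀ {π} → Alternating true false σ (suc m) π ⇔ GlueView true false σ m π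
    view = Alternating-glue {true} {false} {σ}
    forward : ∀ {π} → GlueView true false σ m π → (GlueWithMax UDσ m ∪ GlueClass (UDInc r′) UU m) π
    forward (α , [] , refl , ls , pα , pβ , alt , ¬132α , _ , ¬σ) with to (Up-glue pα pβ) alt
    ... | inj₁ (_ , _ , ())
    ... | inj₂ (oα , uα , _ , _) =
      inj₁ (α , subst (λ k → UDσ k α) (trans (sym (ℕ.+-identityʳ _)) ls)
                  (pα , (oα , uα) , ¬132α , to (GlueFacts.¬HasSigma-glue-[] pα pβ r′ refl) ¬σ) , refl)
    forward (α , β@(x ∷ _) , refl , ls , pα , pβ , alt , ¬132α , ¬132β , ¬σ) with to (Up-glue pα pβ) alt
    ... | inj₁ (_ , () , _)
    ... | inj₂ (oα , uα , oβ , uβ) =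
      let ¬incα , ¬σβ = to (GlueFacts.¬HasSigma-glue pα pβ r′ (x , here refl)) ¬σ
      in inj₂ (GlueClass-intro {UDInc r′} {UU} (pα , (oα , uα) , ¬132α , ¬incα) (s≤s z≤n , pβ , (oβ , uβ) , ¬132β , ¬σβ) ls)
    backward : ∀ {π} → (GlueWithMax UDσ m ∪ GlueClass (UDInc r′) UU m) π → UU (suc m) π
    backward (inj₁ (α , (pα , (oα , uα) , ¬132α , ¬σα) , refl)) =
      s≤s z≤n , from view (glue-[]-view {true} {false} pα (from (Up-glue {α} {[]} (IsPerm-self pα) ↭.refl)
                                               (inj₂ (trans (cong isOdd (IsPerm-length pα)) oα , uα , refl , tt))) ¬132α ¬σα)
    backward (inj₂ g) with GlueClass-elim {UDInc r′} {UU} proj₁ (proj₁ ∘ proj₂) g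
    ... | α , β , refl , (pα , (oα , uα) , ¬132α , ¬incα) , (1≤β , pβ , (oβ , uβ) , ¬132β , ¬σβ) , ls =
      s≤s z≤n ,
      from view (α , β , refl , ls , pα , pβ , from (Up-glue pα pβ) (inj₂ (oα , uα , oβ , uβ)) , ¬132α , ¬132β ,
                 from (GlueFacts.¬HasSigma-glue pα pβ r′ (nonempty 1≤β)) (¬incα , ¬σβ))

  DD-rec : ∀ m π → DD (suc m) π ⇔ GlueClass (DDInc r′) UDσ m π
  DD-rec m π = mk⇔ (forward ∘ to view ∘ proj₂) backward
    where
    view : ∀ {π} → Alternating false false σ (suc m) π ⇔ GlueView false false σ m π
    view = Alternating-glue {false} {false} {σ}
    forward : ∀ {π} → GlueView false false σ m π → GlueClass (DDInc r′) UDσ m π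
    forward (α , β , refl , ls , pα , pβ , alt , ¬132α , ¬132β , ¬σ) =
      let eα , dα , oβ , uβ = to (Down-glue pα pβ) alt
          ¬incα , ¬σβ = to (GlueFacts.¬HasSigma-glue pα pβ r′ (nonempty (isOdd⇒1≤ oβ))) ¬σ
      in GlueClass-intro {DDInc r′} {UDσ} (pα , (eα , dα) , ¬132α , ¬incα) (pβ , (oβ , uβ) , ¬132β , ¬σβ) ls
    backward : ∀ {π} → GlueClass (DDInc r′) UDσ m π → DD (suc m) π
    backward g with GlueClass-elim {DDInc r′} {UDσ} proj₁ proj₁ g
    ... | α , β , refl , (pα , (eα , dα) , ¬132α , ¬incα) , (pβ , (oβ , uβ) , ¬132β , ¬σβ) , ls =
      s≤s z≤n ,
      from view (α , β , refl , ls , pα , pβ , from (Down-glue pα pβ) (eα , dα , oβ , uβ) , ¬132α , ¬132β ,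
                 from (GlueFacts.¬HasSigma-glue pα pβ r′ (nonempty (isOdd⇒1≤ oβ))) (¬incα , ¬σβ))

  DU-rec : ∀ m π → DU (suc m) π ⇔ (GlueWithMax DD m ∪ GlueClass (DDInc r′) UU m) π
  DU-rec m π = mk⇔ (λ (2≤ , a) → forward (ℕ.≤-pred 2≤) (to view a)) backward
    where
    view : ∀ {π} → Alternating false true σ (suc m) π ⇔ GlueView false true σ m π
    view = Alternating-glue {false} {true} {σ}
    forward : ∀ {π} → 1 ≤ m → GlueView false true σ m π → (GlueWithMax DD m ∪ GlueClass (DDInc r′) UU m) π
    forward 1≤m (α , [] , refl , ls , pα , pβ , alt , ¬132α , _ , ¬σ) =
      let eα , dα , _ = to (Down-glue pα pβ) alt in
      inj₁ (α , subst (λ k → DD k α) (trans (sym (ℕ.+-identityʳ _)) ls)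
                  (subst (1 ≤_) (sym (trans (sym (ℕ.+-identityʳ _)) ls)) 1≤m ,
                   pα , (eα , dα) , ¬132α , to (GlueFacts.¬HasSigma-glue-[] pα pβ r′ refl) ¬σ) , refl)
    forward _ (α , β@(x ∷ _) , refl , ls , pα , pβ , alt , ¬132α , ¬132β , ¬σ) =
      let eα , dα , oβ , uβ = to (Down-glue pα pβ) alt
          ¬incα , ¬σβ = to (GlueFacts.¬HasSigma-glue pα pβ r′ (x , here refl)) ¬σ
      in inj₂ (GlueClass-intro {DDInc r′} {UU} (pα , (eα , dα) , ¬132α , ¬incα) (s≤s z≤n , pβ , (oβ , uβ) , ¬132β , ¬σβ) ls)
    backward : ∀ {π} → (GlueWithMax DD m ∪ GlueClass (DDInc r′) UU m) π → DU (suc m) π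
    backward (inj₁ (α , (1≤m , pα , (eα , dα) , ¬132α , ¬σα) , refl)) =
      s≤s 1≤m , from view (glue-[]-view {false} {true} pα (from (Down-glue {α} {[]} (IsPerm-self pα) ↭.refl)
                                                 (trans (cong isOdd (IsPerm-length pα)) eα , dα , refl , tt)) ¬132α ¬σα)
    backward (inj₂ g) with GlueClass-elim {DDInc r′} {UU} proj₁ (proj₁ ∘ proj₂) g
    ... | α , β , refl , (pα , (eα , dα) , ¬132α , ¬incα) , (1≤β , pβ , (oβ , uβ) , ¬132β , ¬σβ) , ls =
      s≤s (ℕ.≤-trans 1≤β (subst (length β ≤_) ls (ℕ.m≤n+m _ _))) ,
      from view (α , β , refl , ls , pα , pβ , from (Down-glue pα pβ) (eα , dα , oβ , uβ) , ¬132α , ¬132β ,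
                 from (GlueFacts.¬HasSigma-glue pα pβ r′ (nonempty 1≤β)) (¬incα , ¬σβ))

δ₀ : ℕ → ℕ
δ₀ zero    = 1
δ₀ (suc _) = 0

HasCount-Singleton : ∀ m → HasCount (Singleton m) (δ₀ m)
HasCount-Singleton zero    = HasCount-singleton (1 ∷ []) (λ π → mk⇔ proj₂ (refl ,_))
HasCount-Singleton (suc m) = HasCount-∅ λ { π (() , _) }

Singleton-GlueClass-disjoint : ∀ {P Q : ℕ → Class} {m} → (∀ α → ¬ P 0 α) →
                               ∀ π → Singleton m π → GlueClass P Q m π → ⊥
Singleton-GlueClass-disjoint ¬P0 π (refl , _) (zero , _ , α , _ , Pα , _) = ¬P0 α Pα
Singleton-GlueClass-disjoint ¬P0 π (refl , _) (suc i , s≤s () , _)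

∃HasCount-Singleton-glue : ∀ {C P : ℕ → Class} → PermFamily P → (∀ α → ¬ P 0 α) → (∀ π → ¬ C 0 π) →
  (∀ m π → C (suc m) π ⇔ (Singleton m ∪ GlueClass P C m) π) → (∀ i → ∃ (HasCount (P i))) →
  ∀ n → ∃ (HasCount (C n))
∃HasCount-Singleton-glue {C} {P} permP ¬P0 ¬C0 C-rec cP = <-rec (λ n → ∃ (HasCount (C n))) step
  where
  step : ∀ n → (∀ {j} → j < n → ∃ (HasCount (C j))) → ∃ (HasCount (C n))
  step zero    _   = 0 , HasCount-∅ ¬C0
  step (suc m) rec =
    let c , cc = ∃HasCount-GlueClass permP m cP (λ j j≤m → rec (s≤s j≤m)) in
    δ₀ m + c , HasCount-resp (λ π → ⇔-sym (C-rec m π))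
                 (HasCount-∪ (HasCount-Singleton m) cc (Singleton-GlueClass-disjoint {P} {C} ¬P0))

count-glue-rec : ∀ {C E P Q : ℕ → Class} {c e p q : ℕ → ℕ} → PermFamily P →
  (∀ m π → C (suc m) π ⇔ (E m ∪ GlueClass P Q m) π) → (∀ m π → E m π → GlueClass P Q m π → ⊥) →
  (∀ n → HasCount (C n) (c n)) → (∀ m → HasCount (E m) (e m)) →
  (∀ i → HasCount (P i) (p i)) → (∀ j → HasCount (Q j) (q j)) →
  ∀ m → c (suc m) ≡ e m + convℕ p q m
count-glue-rec permP C-rec disjoint cC cE cP cQ m =
  HasCount-unique (cC (suc m))
    (HasCount-resp (λ π → ⇔-sym (C-rec m π)) (HasCount-∪ (cE m) (HasCount-GlueClass permP m cP cQ) (disjoint m)))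

count-glue-rec₀ : ∀ {C P Q : ℕ → Class} {c p q : ℕ → ℕ} → PermFamily P →
  (∀ m π → C (suc m) π ⇔ GlueClass P Q m π) →
  (∀ n → HasCount (C n) (c n)) → (∀ i → HasCount (P i) (p i)) → (∀ j → HasCount (Q j) (q j)) →
  ∀ m → c (suc m) ≡ 0 + convℕ p q m
count-glue-rec₀ permP C-rec cC cP cQ m =
  HasCount-unique (cC (suc m)) (HasCount-resp (λ π → ⇔-sym (C-rec m π)) (HasCount-GlueClass permP m cP cQ))

nonempty-HasIncreasing-1 : ∀ {n π} → IsPerm (suc n) π → HasIncreasing 1 π
nonempty-HasIncreasing-1 {π = []}    p with IsPerm-length p
... | ()
nonempty-HasIncreasing-1 {π = x ∷ π} _ = x ∷ [] , refl ∷ Sublist.minimum _ , [] ∷ [] , refl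

¬UDInc-length-0 : ∀ h π → ¬ UDInc h 0 π
¬UDInc-length-0 h π (_ , (() , _) , _)

¬UDInc-0 : ∀ n π → ¬ UDInc 0 n π
¬UDInc-0 zero    π (_ , (() , _) , _)
¬UDInc-0 (suc n) π (p , _ , _ , ¬inc) = ¬inc (nonempty-HasIncreasing-1 p)

DDInc-length-0 : ∀ h π → DDInc h 0 π ⇔ π ≡ []
DDInc-length-0 h π = mk⇔ (IsPerm-0 ∘ proj₁)
  (λ { refl → ↭.refl , (refl , tt) , ¬Has132-short (s≤s z≤n) , ¬HasIncreasing-short (s≤s z≤n) })

∃count-UDInc : ∀ h n → ∃ (HasCount (UDInc h n))
∃count-UDInc zero    n = 0 , HasCount-∅ (¬UDInc-0 n)
∃count-UDInc (suc h)   = ∃HasCount-Singleton-glue proj₁ (¬UDInc-length-0 h) (¬UDInc-length-0 (suc h))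
                           (UDInc-rec h) (∃count-UDInc h)

udInc : ℕ → ℕ → ℕ
udInc h n = proj₁ (∃count-UDInc h n)

udInc-count : ∀ h n → HasCount (UDInc h n) (udInc h n)
udInc-count h n = proj₂ (∃count-UDInc h n)

udInc-suc-0 : ∀ h → udInc (suc h) 0 ≡ 0
udInc-suc-0 h = HasCount-unique (udInc-count (suc h) 0) (HasCount-∅ (¬UDInc-length-0 (suc h)))

udInc-rec : ∀ h m → udInc (suc h) (suc m) ≡ δ₀ m + convℕ (udInc h) (udInc (suc h)) m
udInc-rec h =
  count-glue-rec {UDInc (suc h)} {Singleton} {UDInc h} {UDInc (suc h)} proj₁ (UDInc-rec h)
    (λ _ → Singleton-GlueClass-disjoint {UDInc h} {UDInc (suc h)} (¬UDInc-length-0 h))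
    (udInc-count (suc h)) HasCount-Singleton (udInc-count h) (udInc-count (suc h))

∃count-DDInc : ∀ h n → ∃ (HasCount (DDInc h n))
∃count-DDInc h       zero    = 1 , HasCount-singleton [] (DDInc-length-0 h)
∃count-DDInc zero    (suc m) = 0 , HasCount-∅ λ π (p , _ , _ , ¬inc) → ¬inc (nonempty-HasIncreasing-1 p)
∃count-DDInc (suc h) (suc m) =
  let c , cc = ∃HasCount-GlueClass proj₁ m (∃count-DDInc h) (λ j _ → ∃count-UDInc (suc h) j)
  in c , HasCount-resp (λ π → ⇔-sym (DDInc-rec h m π)) cc

ddInc : ℕ → ℕ → ℕ
ddInc h n = proj₁ (∃count-DDInc h n)

ddInc-count : ∀ h n → HasCount (DDInc h n) (ddInc h n)
ddInc-count h n = proj₂ (∃count-DDInc h n)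

ddInc-rec : ∀ h m → ddInc (suc h) (suc m) ≡ 0 + convℕ (ddInc h) (udInc (suc h)) m
ddInc-rec h = count-glue-rec₀ {DDInc (suc h)} {DDInc h} {UDInc (suc h)} proj₁ (DDInc-rec h)
                (ddInc-count (suc h)) (ddInc-count h) (udInc-count (suc h))

GlueWithMax-GlueClass-disjoint : ∀ {P P′ Q : ℕ → Class} {m} → PermFamily P → PermFamily P′ → PermFamily Q →
  (∀ {j β} → Q j β → 1 ≤ j) → ∀ π → GlueWithMax P m π → GlueClass P′ Q m π → ⊥
GlueWithMax-GlueClass-disjoint permP permP′ permQ Q≥1 π (α , Pα , refl) (i , _ , α′ , β′ , P′α′ , Qβ′ , e)
  with glue-injective {β = []} (IsPerm-self (permP Pα)) (IsPerm-self (permP′ P′α′)) e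
... | _ , refl = ℕ.<-irrefl refl (ℕ.≤-trans (Q≥1 Qβ′) (ℕ.≤-reflexive (sym (IsPerm-length (permQ Qβ′)))))

module AvoidingCounts (r′ : ℕ) where

  open Avoiding r′

  ¬UDσ-length-0 : ∀ π → ¬ UDσ 0 π
  ¬UDσ-length-0 π (_ , (() , _) , _)

  ∃count-UDσ : ∀ n → ∃ (HasCount (UDσ n))
  ∃count-UDσ = ∃HasCount-Singleton-glue proj₁ (¬UDInc-length-0 r′) ¬UDσ-length-0 UDσ-rec (∃count-UDInc r′)

  udσ : ℕ → ℕ
  udσ n = proj₁ (∃count-UDσ n)

  udσ-count : ∀ n → HasCount (UDσ n) (udσ n)
  udσ-count n = proj₂ (∃count-UDσ n)

  udσ-0 : udσ 0 ≡ 0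
  udσ-0 = HasCount-unique (udσ-count 0) (HasCount-∅ ¬UDσ-length-0)

  udσ-rec : ∀ m → udσ (suc m) ≡ δ₀ m + convℕ (udInc r′) udσ m
  udσ-rec = count-glue-rec {UDσ} {Singleton} {UDInc r′} {UDσ} proj₁ UDσ-rec
              (λ _ → Singleton-GlueClass-disjoint {UDInc r′} {UDσ} (¬UDInc-length-0 r′))
              udσ-count HasCount-Singleton (udInc-count r′) udσ-count

  count-length-0 : ∀ {C : ℕ → Class} {c : ℕ → ℕ} k → (∀ n → HasCount (AtLeast (suc k) C n) (c n)) → c 0 ≡ 0
  count-length-0 _ cC = HasCount-unique (cC 0) (HasCount-∅ λ { π (() , _) })

  ud-rec : ∀ {ud : ℕ → ℕ} → (∀ n → HasCount (UD n) (ud n)) → ∀ m → ud (suc m) ≡ 0 + convℕ (udInc r′) udσ m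
  ud-rec cUD = count-glue-rec₀ {UD} {UDInc r′} {UDσ} proj₁ UD-rec cUD (udInc-count r′) udσ-count

  uu-rec : ∀ {uu : ℕ → ℕ} → (∀ n → HasCount (UU n) (uu n)) → ∀ m → uu (suc m) ≡ udσ m + convℕ (udInc r′) uu m
  uu-rec cUU = count-glue-rec {UU} {GlueWithMax UDσ} {UDInc r′} {UU} proj₁ UU-rec
    (λ m → GlueWithMax-GlueClass-disjoint {UDσ} {UDInc r′} {UU} {m} proj₁ proj₁ (proj₁ ∘ proj₂) proj₁)
    cUU (λ m → HasCount-GlueWithMax {UDσ} proj₁ m (udσ-count m)) (udInc-count r′) cUU

  dd-rec : ∀ {dd : ℕ → ℕ} → (∀ n → HasCount (DD n) (dd n)) → ∀ m → dd (suc m) ≡ 0 + convℕ (ddInc r′) udσ m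
  dd-rec cDD = count-glue-rec₀ {DD} {DDInc r′} {UDσ} proj₁ DD-rec cDD (ddInc-count r′) udσ-count

  du-rec : ∀ {dd uu du : ℕ → ℕ} → (∀ n → HasCount (DD n) (dd n)) → (∀ n → HasCount (UU n) (uu n)) →
           (∀ n → HasCount (DU n) (du n)) → ∀ m → du (suc m) ≡ dd m + convℕ (ddInc r′) uu m
  du-rec cDD cUU cDU = count-glue-rec {DU} {GlueWithMax DD} {DDInc r′} {UU} proj₁ DU-rec
    (λ m → GlueWithMax-GlueClass-disjoint {DD} {DDInc r′} {UU} {m} (proj₁ ∘ proj₂) proj₁ (proj₁ ∘ proj₂) proj₁)
    cDU (λ m → HasCount-GlueWithMax {DD} (proj₁ ∘ proj₂) m (cDD m)) (ddInc-count r′) cUU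

cv : PS → PS → PS
cv f g n = sumℤ (applyUpTo (λ i → f i *ᶻ g (n ∸ i)) (suc n))

conv≗cv : ∀ f g → conv f g ≗ cv f g
conv≗cv f g n = cong sumℤ (List.map-applyUpTo (λ i → i) (λ i → f i *ᶻ g (n ∸ i)) (suc n))

tl : PS → PS
tl f = f ∘ suc

zps : PS
zps _ = + 0

addp : PS → PS → PS
addp f g n = f n +ᶻ g n

negp : PS → PS
negp f n = -ᶻ f n

scal : ℤ → PS → PS
scal c f n = c *ᶻ f n

cv-cong : ∀ {f f' g g'} → f ≗ f' → g ≗ g' → cv f g ≗ cv f' g'
cv-cong {f} {f'} {g} {g'} p q zero = cong₂ _+ᶻ_ (cong₂ _*ᶻ_ (p 0) (q 0)) refl
cv-cong {f} {f'} {g} {g'} p q (suc n) =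
  cong₂ _+ᶻ_ (cong₂ _*ᶻ_ (p 0) (q (suc n))) (cv-cong {tl f} {tl f'} {g} {g'} (λ i → p (suc i)) q n)

cv-zeroˡ : ∀ g → cv zps g ≗ zps
cv-zeroˡ g zero = cong (_+ᶻ + 0) (ℤₚ.*-zeroˡ (g 0))
cv-zeroˡ g (suc n) = trans (cong₂ _+ᶻ_ (ℤₚ.*-zeroˡ (g (suc n))) (cv-zeroˡ g n)) refl

cv-addˡ : ∀ f g h → cv (addp f g) h ≗ addp (cv f h) (cv g h)
cv-addˡ f g h zero = l (f 0) (g 0) (h 0)
  where
  l : ∀ a b c → (a +ᶻ b) *ᶻ c +ᶻ + 0 ≡ (a *ᶻ c +ᶻ + 0) +ᶻ (b *ᶻ c +ᶻ + 0)
  l = ℤ-Solver.solve-∀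
cv-addˡ f g h (suc n) = begin
  (f 0 +ᶻ g 0) *ᶻ h (suc n) +ᶻ cv (addp (tl f) (tl g)) h n
    ≡⟨ cong ((f 0 +ᶻ g 0) *ᶻ h (suc n) +ᶻ_) (cv-addˡ (tl f) (tl g) h n) ⟩
  (f 0 +ᶻ g 0) *ᶻ h (suc n) +ᶻ (cv (tl f) h n +ᶻ cv (tl g) h n)
    ≡⟨ lem (f 0) (g 0) (h (suc n)) (cv (tl f) h n) (cv (tl g) h n) ⟩
  (f 0 *ᶻ h (suc n) +ᶻ cv (tl f) h n) +ᶻ (g 0 *ᶻ h (suc n) +ᶻ cv (tl g) h n) ∎
  where
  open ≡-Reasoning
  lem : ∀ a b c d e → (a +ᶻ b) *ᶻ c +ᶻ (d +ᶻ e) ≡ (a *ᶻ c +ᶻ d) +ᶻ (b *ᶻ c +ᶻ e)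
  lem = ℤ-Solver.solve-∀

cv-recʳ : ∀ f g n → cv f g (suc n) ≡ cv f (tl g) n +ᶻ f (suc n) *ᶻ g 0
cv-recʳ f g zero = l (f 0) (g 1) (f 1) (g 0)
  where
  l : ∀ a b c d → a *ᶻ b +ᶻ (c *ᶻ d +ᶻ + 0) ≡ (a *ᶻ b +ᶻ + 0) +ᶻ c *ᶻ d
  l = ℤ-Solver.solve-∀
cv-recʳ f g (suc n) = begin
  f 0 *ᶻ g (suc (suc n)) +ᶻ cv (tl f) g (suc n)
    ≡⟨ cong (f 0 *ᶻ g (suc (suc n)) +ᶻ_) (cv-recʳ (tl f) g n) ⟩
  f 0 *ᶻ g (suc (suc n)) +ᶻ (cv (tl f) (tl g) n +ᶻ f (suc (suc n)) *ᶻ g 0)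
    ≡⟨ ℤₚ.+-assoc (f 0 *ᶻ g (suc (suc n))) _ _ ⟨
  cv f (tl g) (suc n) +ᶻ f (suc (suc n)) *ᶻ g 0 ∎
  where open ≡-Reasoning

cv-comm : ∀ f g → cv f g ≗ cv g f
cv-comm f g zero = cong (_+ᶻ + 0) (ℤₚ.*-comm (f 0) (g 0))
cv-comm f g (suc n) = begin
  cv f g (suc n) ≡⟨ cv-recʳ f g n ⟩
  cv f (tl g) n +ᶻ f (suc n) *ᶻ g 0 ≡⟨ cong₂ _+ᶻ_ (cv-comm f (tl g) n) (ℤₚ.*-comm (f (suc n)) (g 0)) ⟩
  cv (tl g) f n +ᶻ g 0 *ᶻ f (suc n) ≡⟨ ℤₚ.+-comm (cv (tl g) f n) _ ⟩
  cv g f (suc n) ∎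
  where open ≡-Reasoning

cv-tl : ∀ f g → tl (cv f g) ≗ addp (scal (f 0) (tl g)) (cv (tl f) g)
cv-tl f g n = refl

cv-scalˡ : ∀ c f g → cv (scal c f) g ≗ scal c (cv f g)
cv-scalˡ c f g zero = l c (f 0) (g 0)
  where
  l : ∀ a b d → a *ᶻ b *ᶻ d +ᶻ + 0 ≡ a *ᶻ (b *ᶻ d +ᶻ + 0)
  l = ℤ-Solver.solve-∀
cv-scalˡ c f g (suc n) = trans (cong (c *ᶻ f 0 *ᶻ g (suc n) +ᶻ_) (cv-scalˡ c (tl f) g n))
  (lem c (f 0) (g (suc n)) (cv (tl f) g n))
  where
  lem : ∀ a b d e → a *ᶻ b *ᶻ d +ᶻ a *ᶻ e ≡ a *ᶻ (b *ᶻ d +ᶻ e)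
  lem = ℤ-Solver.solve-∀

cv-assoc : ∀ f g h → cv (cv f g) h ≗ cv f (cv g h)
cv-assoc f g h zero = l (f 0) (g 0) (h 0)
  where
  l : ∀ a b d → (a *ᶻ b +ᶻ + 0) *ᶻ d +ᶻ + 0 ≡ a *ᶻ (b *ᶻ d +ᶻ + 0) +ᶻ + 0
  l = ℤ-Solver.solve-∀
cv-assoc f g h (suc n) = begin
  cv f g 0 *ᶻ h (suc n) +ᶻ cv (tl (cv f g)) h n
    ≡⟨ cong (cv f g 0 *ᶻ h (suc n) +ᶻ_) (cv-cong {tl (cv f g)} {addp (scal (f 0) (tl g)) (cv (tl f) g)} {h} {h} (cv-tl f g) (λ _ → refl) n) ⟩
  cv f g 0 *ᶻ h (suc n) +ᶻ cv (addp (scal (f 0) (tl g)) (cv (tl f) g)) h n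
    ≡⟨ cong (cv f g 0 *ᶻ h (suc n) +ᶻ_) (cv-addˡ (scal (f 0) (tl g)) (cv (tl f) g) h n) ⟩
  cv f g 0 *ᶻ h (suc n) +ᶻ (cv (scal (f 0) (tl g)) h n +ᶻ cv (cv (tl f) g) h n)
    ≡⟨ cong (λ z → cv f g 0 *ᶻ h (suc n) +ᶻ (z +ᶻ cv (cv (tl f) g) h n)) (cv-scalˡ (f 0) (tl g) h n) ⟩
  cv f g 0 *ᶻ h (suc n) +ᶻ (f 0 *ᶻ cv (tl g) h n +ᶻ cv (cv (tl f) g) h n)
    ≡⟨ cong (λ z → cv f g 0 *ᶻ h (suc n) +ᶻ (f 0 *ᶻ cv (tl g) h n +ᶻ z)) (cv-assoc (tl f) g h n) ⟩
  cv f g 0 *ᶻ h (suc n) +ᶻ (f 0 *ᶻ cv (tl g) h n +ᶻ cv (tl f) (cv g h) n)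
    ≡⟨ lem (f 0) (g 0) (h (suc n)) (cv (tl g) h n) (cv (tl f) (cv g h) n) ⟩
  f 0 *ᶻ (g 0 *ᶻ h (suc n) +ᶻ cv (tl g) h n) +ᶻ cv (tl f) (cv g h) n ∎
  where
  open ≡-Reasoning
  lem : ∀ a b c d e → (a *ᶻ b +ᶻ + 0) *ᶻ c +ᶻ (a *ᶻ d +ᶻ e) ≡ a *ᶻ (b *ᶻ c +ᶻ d) +ᶻ e
  lem = ℤ-Solver.solve-∀

≗-sym : ∀ {f g : PS} → f ≗ g → g ≗ f
≗-sym p n = sym (p n)
≗-trans : ∀ {f g h : PS} → f ≗ g → g ≗ h → f ≗ h
≗-trans p q n = trans (p n) (q n)

addp-cong : ∀ {f f' g g'} → f ≗ f' → g ≗ g' → addp f g ≗ addp f' g'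
addp-cong p q n = cong₂ _+ᶻ_ (p n) (q n)

shift-cong : ∀ t {f g} → f ≗ g → shift t f ≗ shift t g
shift-cong zero p n = p n
shift-cong (suc t) p zero = refl
shift-cong (suc t) p (suc n) = shift-cong t p n

shift-eq : ∀ {a b} f → a ≡ b → shift a f ≗ shift b f
shift-eq f refl n = refl

shift-+ : ∀ a b f → shift a (shift b f) ≗ shift (a + b) f
shift-+ zero b f n = refl
shift-+ (suc a) b f zero = refl
shift-+ (suc a) b f (suc n) = shift-+ a b f n

shift-at : ∀ t f n → shift t f (t + n) ≡ f n
shift-at zero f n = refl
shift-at (suc t) f n = shift-at t f n

shift-cancel : ∀ t {f g} → shift t f ≗ shift t g → f ≗ g
shift-cancel t {f} {g} p n = trans (sym (shift-at t f n)) (trans (p (t + n)) (shift-at t g n))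

shift-add : ∀ t f g → shift t (addp f g) ≗ addp (shift t f) (shift t g)
shift-add zero f g n = refl
shift-add (suc t) f g zero = refl
shift-add (suc t) f g (suc n) = shift-add t f g n

shift-neg : ∀ t f → shift t (negp f) ≗ negp (shift t f)
shift-neg zero f n = refl
shift-neg (suc t) f zero = refl
shift-neg (suc t) f (suc n) = shift-neg t f n

shift-zero : ∀ t → shift t zps ≗ zps
shift-zero zero n = refl
shift-zero (suc t) zero = refl
shift-zero (suc t) (suc n) = shift-zero t n

cv-shiftˡ : ∀ t f g → cv (shift t f) g ≗ shift t (cv f g)
cv-shiftˡ zero f g n = refl
cv-shiftˡ (suc t) f g zero = cong (_+ᶻ + 0) (ℤₚ.*-zeroˡ (g 0))
cv-shiftˡ (suc t) f g (suc n) = trans (cong₂ _+ᶻ_ (ℤₚ.*-zeroˡ (g (suc n))) (cv-shiftˡ t f g n)) (ℤₚ.+-identityˡ _)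

cv-shiftʳ : ∀ t f g → cv f (shift t g) ≗ shift t (cv f g)
cv-shiftʳ t f g = ≗-trans (cv-comm f (shift t g)) (≗-trans (cv-shiftˡ t g f) (shift-cong t (cv-comm g f)))

conv-cong : ∀ {f f' g g'} → f ≗ f' → g ≗ g' → conv f g ≗ conv f' g'
conv-cong {f} {f'} {g} {g'} p q n = trans (conv≗cv f g n) (trans (cv-cong p q n) (sym (conv≗cv f' g' n)))

-- Laurent series form a commutative ring

≈-from-shift : ∀ u {s t f g} → shift (t + u) f ≗ shift (s + u) g → (s , f) ≈ (t , g)
≈-from-shift u {s} {t} {f} {g} p = shift-cancel u (≗-trans (shift-+ u t f) (≗-trans (shift-eq f (ℕ.+-comm u t))
  (≗-trans p (≗-trans (shift-eq g (ℕ.+-comm s u)) (≗-sym (shift-+ u s g))))))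

≈-refl : ∀ {a} → a ≈ a
≈-refl {s , f} n = refl

≈-sym : ∀ {a b} → a ≈ b → b ≈ a
≈-sym {s , f} {t , g} p n = sym (p n)

≈-trans : ∀ {a b c} → a ≈ b → b ≈ c → a ≈ c
≈-trans {s , f} {t , g} {u , h} p q = ≈-from-shift t {s} {u} {f} {h}
  (≗-trans (≗-sym (shift-+ u t f)) (≗-trans (shift-cong u p) (≗-trans (shift-+ u s g)
  (≗-trans (shift-eq g (ℕ.+-comm u s)) (≗-trans (≗-sym (shift-+ s u g)) (≗-trans (shift-cong s q)
  (shift-+ s t h)))))))

shift-shift : ∀ a b c d f → a + b ≡ c + d → shift a (shift b f) ≗ shift c (shift d f)
shift-shift a b c d f e = ≗-trans (shift-+ a b f) (≗-trans (shift-eq f e) (≗-sym (shift-+ c d f)))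

step : ∀ {s s' f f'} A B C D E → (s , f) ≈ (s' , f') → A + B ≡ E + s' → E + s ≡ C + D →
       shift A (shift B f) ≗ shift C (shift D f')
step {s} {s'} {f} {f'} A B C D E p e1 e2 = ≗-trans (shift-shift A B E s' f e1) (≗-trans (shift-cong E p) (shift-shift E s C D f' e2))

⊕-cong : ∀ {a a' b b'} → a ≈ a' → b ≈ b' → a ⊕ b ≈ a' ⊕ b'
⊕-cong {s , f} {s' , f'} {t , g} {t' , g'} p q =
  ≗-trans (shift-add (s' + t') (shift t f) (shift s g))
  (≗-trans (addp-cong (step (s' + t') t (s + t) t' (t' + t) p (i1 s s' t t') (i2 s s' t t'))
                      (step (s' + t') s (s + t) s' (s' + s) q (i3 s s' t t') (i4 s s' t t')))
   (≗-sym (shift-add (s + t) (shift t' f') (shift s' g'))))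
  where
  i1 : ∀ s s' t t' → (s' + t') + t ≡ (t' + t) + s'
  i1 = ℕ-Solver.solve-∀
  i2 : ∀ s s' t t' → (t' + t) + s ≡ (s + t) + t'
  i2 = ℕ-Solver.solve-∀
  i3 : ∀ s s' t t' → (s' + t') + s ≡ (s' + s) + t'
  i3 = ℕ-Solver.solve-∀
  i4 : ∀ s s' t t' → (s' + s) + t ≡ (s + t) + s'
  i4 = ℕ-Solver.solve-∀

≈-intro : ∀ {s t F G} → s ≡ t → F ≗ G → (s , F) ≈ (t , G)
≈-intro {s} {t} {F} {G} e p = ≗-trans (shift-cong t p) (shift-eq G (sym e))

⊖-cong : ∀ {a a'} → a ≈ a' → ⊖ a ≈ ⊖ a'
⊖-cong {s , f} {s' , f'} p = ≗-trans (shift-neg s' f) (≗-trans (λ n → cong -ᶻ_ (p n)) (≗-sym (shift-neg s f')))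

conv-shift : ∀ a b f g → conv (shift a f) (shift b g) ≗ shift (a + b) (conv f g)
conv-shift a b f g = ≗-trans (conv≗cv (shift a f) (shift b g)) (≗-trans (cv-shiftˡ a f (shift b g))
  (≗-trans (shift-cong a (cv-shiftʳ b f g)) (≗-trans (shift-+ a b (cv f g)) (shift-cong (a + b) (≗-sym (conv≗cv f g))))))

⊗-cong : ∀ {a a' b b'} → a ≈ a' → b ≈ b' → a ⊗ b ≈ a' ⊗ b'
⊗-cong {s , f} {s' , f'} {t , g} {t' , g'} p q =
  ≗-trans (≗-sym (conv-shift s' t' f g)) (≗-trans (conv-cong p q) (conv-shift s t f' g'))

δ : PS
δ zero = + 1
δ (suc _) = + 0

cv-δ : ∀ f → cv δ f ≗ f
cv-δ f zero = trans (ℤₚ.+-identityʳ _) (ℤₚ.*-identityˡ (f 0))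
cv-δ f (suc n) =
  trans (cong₂ _+ᶻ_ (ℤₚ.*-identityˡ (f (suc n))) (≗-trans (cv-cong {tl δ} {zps} {f} {f} (λ _ → refl) (λ _ → refl)) (cv-zeroˡ f) n))
        (ℤₚ.+-identityʳ _)

⊕-comm : ∀ a b → a ⊕ b ≈ b ⊕ a
⊕-comm (s , f) (t , g) = ≈-intro (ℕ.+-comm s t) (λ n → ℤₚ.+-comm (shift t f n) (shift s g n))

⊕-assoc : ∀ a b c → (a ⊕ b) ⊕ c ≈ a ⊕ (b ⊕ c)
⊕-assoc (s , f) (t , g) (u , h) = ≈-intro (ℕ.+-assoc s t u) λ n →
  trans (cong (_+ᶻ shift (s + t) h n) (shift-add u (shift t f) (shift s g) n))
  (trans (ℤₚ.+-assoc (shift u (shift t f) n) (shift u (shift s g) n) (shift (s + t) h n))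
  (cong₂ _+ᶻ_ (shift-shift u t (t + u) 0 f (i1 t u) n)
     (trans (cong₂ _+ᶻ_ (shift-shift u s s u g (ℕ.+-comm u s) n) (shift-shift 0 (s + t) s t h refl n))
       (sym (shift-add s (shift u g) (shift t h) n)))))
  where
  i1 : ∀ t u → u + t ≡ (t + u) + 0
  i1 = ℕ-Solver.solve-∀

const-0≗0 : proj₂ (const (+ 0)) ≗ zps
const-0≗0 zero = refl
const-0≗0 (suc n) = refl

⊕-identityˡ : ∀ a → const (+ 0) ⊕ a ≈ a
⊕-identityˡ (s , f) = ≈-intro {0 + s} {s} {addp (shift s (proj₂ (const (+ 0)))) f} {f} refl λ n →
  trans (cong (_+ᶻ f n) (≗-trans (shift-cong s {proj₂ (const (+ 0))} {zps} const-0≗0) (shift-zero s) n))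
        (ℤₚ.+-identityˡ (f n))

⊕-inverseˡ : ∀ a → (⊖ a) ⊕ a ≈ const (+ 0)
⊕-inverseˡ (s , f) n =
  trans (trans (sym (shift-add s (negp f) f n))
               (≗-trans (shift-cong s {addp (negp f) f} {zps} (λ m → ℤₚ.+-inverseˡ (f m))) (shift-zero s) n))
        (sym (≗-trans (shift-cong (s + s) const-0≗0) (shift-zero (s + s)) n))

⊗-comm : ∀ a b → a ⊗ b ≈ b ⊗ a
⊗-comm (s , f) (t , g) = ≈-intro (ℕ.+-comm s t) (≗-trans (conv≗cv f g) (≗-trans (cv-comm f g) (≗-sym (conv≗cv g f))))

⊗-assoc : ∀ a b c → (a ⊗ b) ⊗ c ≈ a ⊗ (b ⊗ c)
⊗-assoc (s , f) (t , g) (u , h) = ≈-intro (ℕ.+-assoc s t u)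
  (≗-trans (conv≗cv (conv f g) h) (≗-trans (cv-cong (conv≗cv f g) (λ _ → refl)) (≗-trans (cv-assoc f g h)
  (≗-trans (cv-cong {f} {f} (λ _ → refl) (≗-sym (conv≗cv g h))) (≗-sym (conv≗cv f (conv g h)))))))

⊗-identityˡ : ∀ a → const (+ 1) ⊗ a ≈ a
⊗-identityˡ (s , f) = ≈-intro {0 + s} {s} {conv (proj₂ (const (+ 1))) f} {f} refl
  (≗-trans (conv≗cv (proj₂ (const (+ 1))) f)
           (≗-trans (cv-cong {proj₂ (const (+ 1))} {δ} {f} {f} (λ { zero → refl ; (suc _) → refl }) (λ _ → refl)) (cv-δ f)))

⊗-distribʳ : ∀ a b c → (b ⊕ c) ⊗ a ≈ (b ⊗ a) ⊕ (c ⊗ a)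
⊗-distribʳ (s , f) (t , g) (u , h) =
  ≗-trans (shift-cong P conv-distrib) (≗-trans (shift-add P (shift u (conv g f)) (shift t (conv h f)))
  (≗-trans (addp-cong (shift-shift P u Q (u + s) (conv g f) (i1 s t u)) (shift-shift P t Q (t + s) (conv h f) (i2 s t u)))
   (≗-sym (shift-add Q (shift (u + s) (conv g f)) (shift (t + s) (conv h f))))))
  where
  P Q : ℕ
  P = (t + s) + (u + s)
  Q = (t + u) + s
  i1 : ∀ s t u → ((t + s) + (u + s)) + u ≡ ((t + u) + s) + (u + s)
  i1 = ℕ-Solver.solve-∀
  i2 : ∀ s t u → ((t + s) + (u + s)) + t ≡ ((t + u) + s) + (t + s)
  i2 = ℕ-Solver.solve-∀
  conv-distrib : conv (addp (shift u g) (shift t h)) f ≗ addp (shift u (conv g f)) (shift t (conv h f))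
  conv-distrib = ≗-trans (conv≗cv (addp (shift u g) (shift t h)) f) (≗-trans (cv-addˡ (shift u g) (shift t h) f)
       (addp-cong (≗-trans (cv-shiftˡ u g f) (shift-cong u (≗-sym (conv≗cv g f))))
                  (≗-trans (cv-shiftˡ t h f) (shift-cong t (≗-sym (conv≗cv h f))))))

-- _≈_ computes to a Π-type, so its arguments cannot be inferred from it; the record wrapper
-- gives an injective equality for the ring solver
infix 4 _≋_
record _≋_ (a b : LS) : Set where
  constructor wrap
  field unwrap : a ≈ b
open _≋_

≋-isEquivalence : IsEquivalence _≋_
≋-isEquivalence = record
  { refl  = λ {a} → wrap (≈-refl {a})
  ; sym   = λ {a} {b} p → wrap (≈-sym {a} {b} (unwrap p))
  ; trans = λ {a} {b} {c} p q → wrap (≈-trans {a} {b} {c} (unwrap p) (unwrap q))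
  }

LS-isCommutativeRing : IsCommutativeRing _≋_ _⊕_ _⊗_ ⊖_ (const (+ 0)) (const (+ 1))
LS-isCommutativeRing = record
  { isRing = record
    { +-isAbelianGroup = record
      { isGroup = record
        { isMonoid = record
          { isSemigroup = record
            { isMagma = record { isEquivalence = ≋-isEquivalence ; ∙-cong = λ {a} {a'} {b} {b'} p q → wrap (⊕-cong {a} {a'} {b} {b'} (unwrap p) (unwrap q)) }
            ; assoc = λ a b c → wrap (⊕-assoc a b c) }
          ; identity = (λ a → wrap (⊕-identityˡ a)) , (λ a → wrap (≈-trans {a ⊕ const (+ 0)} {const (+ 0) ⊕ a} {a} (⊕-comm a (const (+ 0))) (⊕-identityˡ a))) }
        ; inverse = (λ a → wrap (⊕-inverseˡ a)) , (λ a → wrap (≈-trans {a ⊕ (⊖ a)} {(⊖ a) ⊕ a} {const (+ 0)} (⊕-comm a (⊖ a)) (⊕-inverseˡ a)))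
        ; ⁻¹-cong = λ {a} {a'} p → wrap (⊖-cong {a} {a'} (unwrap p)) }
      ; comm = λ a b → wrap (⊕-comm a b) }
    ; *-cong = λ {a} {a'} {b} {b'} p q → wrap (⊗-cong {a} {a'} {b} {b'} (unwrap p) (unwrap q))
    ; *-assoc = λ a b c → wrap (⊗-assoc a b c)
    ; *-identity = (λ a → wrap (⊗-identityˡ a)) , (λ a → wrap (≈-trans {a ⊗ const (+ 1)} {const (+ 1) ⊗ a} {a} (⊗-comm a (const (+ 1))) (⊗-identityˡ a)))
    ; distrib = (λ a b c → wrap (≈-trans {a ⊗ (b ⊕ c)} {(b ⊕ c) ⊗ a} {(a ⊗ b) ⊕ (a ⊗ c)} (⊗-comm a (b ⊕ c))
                   (≈-trans {(b ⊕ c) ⊗ a} {(b ⊗ a) ⊕ (c ⊗ a)} {(a ⊗ b) ⊕ (a ⊗ c)} (⊗-distribʳ a b c)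
                     (⊕-cong {b ⊗ a} {a ⊗ b} {c ⊗ a} {a ⊗ c} (⊗-comm b a) (⊗-comm c a)))))
              , (λ a b c → wrap (⊗-distribʳ a b c)) }
  ; *-comm = λ a b → wrap (⊗-comm a b) }

LS-commutativeRing : CommutativeRing 0ℓ 0ℓ
LS-commutativeRing = record { isCommutativeRing = LS-isCommutativeRing }

LS-almostCommutativeRing : ACR.AlmostCommutativeRing 0ℓ 0ℓ
LS-almostCommutativeRing = ACR.fromCommutativeRing LS-commutativeRing

const-tail-cv : ∀ a b n → cv (tl (proj₂ (const a))) (proj₂ (const b)) n ≡ + 0
const-tail-cv a b = ≗-trans (cv-cong {tl (proj₂ (const a))} {zps} {proj₂ (const b)} (λ _ → refl) (λ _ → refl))
                            (cv-zeroˡ (proj₂ (const b)))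

const-hom : ℤ.+-*-rawRing ACR.-Raw-AlmostCommutative⟶ LS-almostCommutativeRing
const-hom = record
  { ⟦_⟧ = const
  ; +-homo = λ a b → wrap (λ { zero → refl ; (suc n) → refl })
  ; *-homo = λ a b → wrap (λ { zero → sym (trans (conv≗cv (proj₂ (const a)) (proj₂ (const b)) 0) (ℤₚ.+-identityʳ _))
                             ; (suc n) → sym (trans (conv≗cv (proj₂ (const a)) (proj₂ (const b)) (suc n))
                                  (cong₂ _+ᶻ_ (ℤₚ.*-zeroʳ a) (const-tail-cv a b n))) })
  ; -‿homo = λ a → wrap (λ { zero → refl ; (suc n) → refl })
  ; 0-homo = wrap (λ { zero → refl ; (suc n) → refl })
  ; 1-homo = wrap (λ { zero → refl ; (suc n) → refl })
  }

coeff≟ : ∀ a b → Maybe (const a ≋ const b)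
coeff≟ a b = fromDec (a ℤ.≟ b)
  where
  fromDec : Dec (a ≡ b) → Maybe (const a ≋ const b)
  fromDec (yes refl) = just (wrap (≈-refl {const a}))
  fromDec (no _)     = nothing
open import Algebra.Solver.Ring ℤ.+-*-rawRing LS-almostCommutativeRing const-hom coeff≟
  using (solve; _:+_; _:*_; _:-_; con; _:=_)

module Ring = ACR.AlmostCommutativeRing LS-almostCommutativeRing

0ᴸ 1ᴸ : LS
0ᴸ = const (+ 0)
1ᴸ = const (+ 1)

+-sum : ∀ (g : ℕ → ℕ) n → + sum (applyUpTo g n) ≡ sumℤ (applyUpTo (λ i → + g i) n)
+-sum g zero = refl
+-sum g (suc n) = trans (ℤₚ.pos-+ (g 0) (sum (applyUpTo (g ∘ suc) n))) (cong (+ g 0 +ᶻ_) (+-sum (g ∘ suc) n))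

+-convℕ : ∀ p q m → + convℕ p q m ≡ cv (λ n → + p n) (λ n → + q n) m
+-convℕ p q m = trans (+-sum (λ i → p i * q (m ∸ i)) (suc m))
  (sum-cong (λ i → + (p i * q (m ∸ i))) (λ i → + p i *ᶻ + q (m ∸ i)) (λ i → ℤₚ.pos-* (p i) (q (m ∸ i))) (suc m))
  where
  sum-cong : ∀ (g h : ℕ → ℤ) → g ≗ h → ∀ n → sumℤ (applyUpTo g n) ≡ sumℤ (applyUpTo h n)
  sum-cong g h e zero = refl
  sum-cong g h e (suc n) = cong₂ _+ᶻ_ (e 0) (sum-cong (g ∘ suc) (h ∘ suc) (λ i → e (suc i)) n)

X : LS
X = xpow 1

cv-X : ∀ F → cv (proj₂ X) F ≗ shift 1 F
cv-X F = ≗-trans (cv-cong {proj₂ X} {shift 1 δ} {F} {F} (λ { zero → refl ; (suc zero) → refl ; (suc (suc n)) → refl }) (λ _ → refl))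
        (≗-trans (cv-shiftˡ 1 δ F) (shift-cong 1 (cv-δ F)))

GF-recurrence : ∀ (c e p q : ℕ → ℕ) → (∀ m → c (suc m) ≡ e m + convℕ p q m) →
         GF c ≋ const (+ c 0) ⊕ X ⊗ (GF e ⊕ GF p ⊗ GF q)
GF-recurrence c e p q rec = wrap λ
  { zero → sym (trans (cong (+ c 0 +ᶻ_) (trans (conv≗cv (proj₂ X) Fs 0) (cv-X Fs 0))) (ℤₚ.+-identityʳ _))
  ; (suc m) → sym (trans (cong (+ 0 +ᶻ_) (trans (conv≗cv (proj₂ X) Fs (suc m)) (cv-X Fs (suc m))))
      (trans (ℤₚ.+-identityˡ _) (trans (cong (+ e m +ᶻ_) (trans (conv≗cv (λ n → + p n) (λ n → + q n) m) (sym (+-convℕ p q m))))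
        (trans (sym (ℤₚ.pos-+ (e m) (convℕ p q m))) (cong +_ (sym (rec m))))))) }
  where
  Fs : PS
  Fs = proj₂ (GF e ⊕ GF p ⊗ GF q)

GF-recurrence′ : ∀ (c e p q : ℕ → ℕ) → (∀ m → c (suc m) ≡ e m + convℕ p q m) → ∀ {z e′} →
                 const (+ c 0) ≋ z → GF e ≋ e′ → GF c ≋ z ⊕ X ⊗ (e′ ⊕ GF p ⊗ GF q)
GF-recurrence′ c e p q rec c0≋z e≋e′ =
  Ring.trans (GF-recurrence c e p q rec) (Ring.+-cong c0≋z (Ring.*-cong (Ring.refl {X}) (Ring.+-cong e≋e′ Ring.refl)))

const-cong : ∀ {a b} → a ≡ b → const (+ a) ≋ const (+ b)
const-cong refl = Ring.refl

GF-δ₀ : GF δ₀ ≋ 1ᴸ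
GF-δ₀ = wrap (λ { zero → refl ; (suc n) → refl })

GF-0 : GF (λ _ → 0) ≋ 0ᴸ
GF-0 = wrap (λ { zero → refl ; (suc n) → refl })

-- Chebyshev algebra

≋⇒⊖≋0 : ∀ {l r} → l ≋ r → l ⊖ r ≋ 0ᴸ
≋⇒⊖≋0 {l} {r} p = Ring.trans (Ring.+-cong p Ring.refl) (solve 1 (λ r → r :- r := con (+ 0)) Ring.refl r)

⊗-zeroʳ-≋ : ∀ c {d} → d ≋ 0ᴸ → c ⊗ d ≋ 0ᴸ
⊗-zeroʳ-≋ c {d} p = Ring.trans (Ring.*-cong (Ring.refl {c}) p) (Ring.zeroʳ c)

⊕-zero-≋ : ∀ {d e} → d ≋ 0ᴸ → e ≋ 0ᴸ → d ⊕ e ≋ 0ᴸ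
⊕-zero-≋ p q = Ring.trans (Ring.+-cong p q) (Ring.+-identityˡ 0ᴸ)

-- Every identity below is proved as L ≋ R ⊕ Σ cᵢ (Lᵢ ⊖ Rᵢ), a ring identity checked by the
-- solver, where each Lᵢ ≋ Rᵢ is a hypothesis or an earlier lemma.
≋-by-certificate : ∀ {L R d} → L ≋ R ⊕ d → d ≋ 0ᴸ → L ≋ R
≋-by-certificate {L} {R} {d} p q = Ring.trans p (Ring.trans (Ring.+-cong (Ring.refl {R}) q) (Ring.+-identityʳ R))

X⊗xinv≋1 : X ⊗ xinv ≋ 1ᴸ
X⊗xinv≋1 = wrap (≗-trans (conv≗cv (proj₂ X) (proj₂ xinv))
                          (≗-trans (cv-X (proj₂ xinv)) λ { zero → refl ; (suc zero) → refl ; (suc (suc n)) → refl }))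

xpow-suc : ∀ m → xpow (suc m) ≋ X ⊗ xpow m
xpow-suc m = wrap (≗-sym (≗-trans (conv≗cv (proj₂ X) (proj₂ (xpow m)))
                                   (≗-trans (cv-X (proj₂ (xpow m))) (λ { zero → refl ; (suc n) → refl }))))

Uc-cassini : ∀ h → Uc h ⊗ Uc h ⊕ Uc (suc h) ⊗ Uc (suc h) ⊖ xinv ⊗ Uc h ⊗ Uc (suc h) ≋ 1ᴸ
Uc-cassini zero = solve 1 (λ Y → con (+ 0) :* con (+ 0) :+ con (+ 1) :* con (+ 1) :- Y :* con (+ 0) :* con (+ 1) := con (+ 1)) Ring.refl xinv
Uc-cassini (suc h) = Ring.trans (solve 3 (λ Y u0 u1 → (u1 :* u1 :+ (Y :* u1 :- u0) :* (Y :* u1 :- u0)) :- Y :* u1 :* (Y :* u1 :- u0)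
                                   := u0 :* u0 :+ u1 :* u1 :- Y :* u0 :* u1) Ring.refl xinv (Uc h) (Uc (suc h)))
                   (Uc-cassini h)

A-ratio-step : ∀ {A' Aₕ u1 u0} → A' ≋ X ⊕ X ⊗ Aₕ ⊗ A' → Aₕ ⊗ u1 ≋ u0 → A' ⊗ (xinv ⊗ u1 ⊖ u0) ≋ u1
A-ratio-step {A'} {Aₕ} {u1} {u0} E1 E2 = ≋-by-certificate
  (solve 6 (λ A' Aₕ x y u1 u0 → A' :* (y :* u1 :- u0)
     := u1 :+ (y :* u1 :* (A' :- (x :+ x :* Aₕ :* A')) :+ y :* x :* A' :* (Aₕ :* u1 :- u0) :+ (u1 :+ A' :* u0) :* (x :* y :- con (+ 1))))
     Ring.refl A' Aₕ X xinv u1 u0)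
  (⊕-zero-≋ (⊕-zero-≋ (⊗-zeroʳ-≋ (xinv ⊗ u1) (≋⇒⊖≋0 E1)) (⊗-zeroʳ-≋ (xinv ⊗ X ⊗ A') (≋⇒⊖≋0 E2)))
            (⊗-zeroʳ-≋ (u1 ⊕ A' ⊗ u0) (≋⇒⊖≋0 X⊗xinv≋1)))

D-ratio-step : ∀ {D' Dₕ A' u1 u0 P P'} → D' ≋ 1ᴸ ⊕ X ⊗ Dₕ ⊗ A' → A' ⊗ (xinv ⊗ u1 ⊖ u0) ≋ u1 →
        X ⊗ Dₕ ⊗ u1 ≋ P ⊕ u0 → P' ≋ X ⊗ P → X ⊗ D' ⊗ (xinv ⊗ u1 ⊖ u0) ≋ P' ⊕ u1
D-ratio-step {D'} {Dₕ} {A'} {u1} {u0} {P} {P'} E1 E2 E3 E4 = ≋-by-certificate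
  (solve 9 (λ D' Dₕ A' u1 u0 P P' x y → x :* D' :* (y :* u1 :- u0)
     := (P' :+ u1) :+ (x :* (y :* u1 :- u0) :* (D' :- (con (+ 1) :+ x :* Dₕ :* A')) :+ x :* x :* Dₕ :* (A' :* (y :* u1 :- u0) :- u1)
          :+ x :* (x :* Dₕ :* u1 :- (P :+ u0)) :+ u1 :* (x :* y :- con (+ 1)) :+ con (ℤ.-[1+ 0 ]) :* (P' :- x :* P)))
     Ring.refl D' Dₕ A' u1 u0 P P' X xinv)
  (⊕-zero-≋ (⊕-zero-≋ (⊕-zero-≋ (⊕-zero-≋
    (⊗-zeroʳ-≋ (X ⊗ (xinv ⊗ u1 ⊖ u0)) (≋⇒⊖≋0 E1))
    (⊗-zeroʳ-≋ (X ⊗ X ⊗ Dₕ) (≋⇒⊖≋0 E2)))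
    (⊗-zeroʳ-≋ X (≋⇒⊖≋0 E3)))
    (⊗-zeroʳ-≋ u1 (≋⇒⊖≋0 X⊗xinv≋1)))
    (⊗-zeroʳ-≋ (const (ℤ.-[1+ 0 ])) (≋⇒⊖≋0 E4)))

module ChebyshevSolution (h₀ : ℕ) (A D : ℕ → LS) (Q UD UU DD DU : LS)
  (A-0 : A 0 ≋ 0ᴸ) (A-suc : ∀ h → A (suc h) ≋ X ⊕ X ⊗ A h ⊗ A (suc h))
  (D-0 : D 0 ≋ 1ᴸ) (D-suc : ∀ h → D (suc h) ≋ 1ᴸ ⊕ X ⊗ D h ⊗ A (suc h))
  (Q-eq : Q ≋ X ⊕ X ⊗ A h₀ ⊗ Q) (UD-eq : UD ≋ X ⊗ A h₀ ⊗ Q)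
  (UU-eq : UU ≋ X ⊗ Q ⊕ X ⊗ A h₀ ⊗ UU) (DD-eq : DD ≋ X ⊗ D h₀ ⊗ Q)
  (DU-eq : DU ≋ X ⊗ DD ⊕ X ⊗ D h₀ ⊗ UU) where

  A-Uc : ∀ h → A h ⊗ Uc (suc h) ≋ Uc h
  A-Uc zero    = Ring.trans (Ring.*-cong A-0 (Ring.refl {1ᴸ})) (solve 0 (con (+ 0) :* con (+ 1) := con (+ 0)) Ring.refl)
  A-Uc (suc h) = A-ratio-step {A (suc h)} {A h} {Uc (suc h)} {Uc h} (A-suc h) (A-Uc h)

  D-Uc : ∀ h → X ⊗ D h ⊗ Uc (suc h) ≋ xpow (suc h) ⊕ Uc h
  D-Uc zero    = Ring.trans (Ring.*-cong (Ring.*-cong (Ring.refl {X}) D-0) (Ring.refl {1ᴸ}))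
                   (solve 1 (λ x → x :* con (+ 1) :* con (+ 1) := x :+ con (+ 0)) Ring.refl X)
  D-Uc (suc h) = D-ratio-step {D (suc h)} {D h} {A (suc h)} {Uc (suc h)} {Uc h} {xpow (suc h)} {xpow (suc (suc h))}
                   (D-suc h) (A-Uc (suc h)) (D-Uc h) (xpow-suc (suc h))

  private
    u0 u1 u2 xʰ xʰ⁺¹ Aₕ Dₕ : LS
    u0   = Uc h₀
    u1   = Uc (suc h₀)
    u2   = Uc (suc (suc h₀))
    xʰ   = xpow h₀
    xʰ⁺¹ = xpow (suc h₀)
    Aₕ   = A h₀
    Dₕ   = D h₀

    Q-Uc : Q ⊗ u2 ≋ u1
    Q-Uc = A-ratio-step {Q} {Aₕ} {u1} {u0} Q-eq (A-Uc h₀)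

  UD-solution : UD ⊗ u2 ≋ X ⊗ u0
  UD-solution = ≋-by-certificate
    (solve 7 (λ UD Q A x y u1 u0 → UD :* (y :* u1 :- u0) := x :* u0 :+
                ((y :* u1 :- u0) :* (UD :- x :* A :* Q) :+ x :* A :* (Q :* (y :* u1 :- u0) :- u1) :+ x :* (A :* u1 :- u0)))
             Ring.refl UD Q Aₕ X xinv u1 u0)
    (⊕-zero-≋ (⊕-zero-≋ (⊗-zeroʳ-≋ u2 (≋⇒⊖≋0 UD-eq)) (⊗-zeroʳ-≋ (X ⊗ Aₕ) (≋⇒⊖≋0 Q-Uc)))
              (⊗-zeroʳ-≋ X (≋⇒⊖≋0 (A-Uc h₀))))

  DD-solution : DD ⊗ u2 ≋ xʰ⁺¹ ⊕ u0
  DD-solution = ≋-by-certificate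
    (solve 8 (λ DD Q D x y u1 u0 P → DD :* (y :* u1 :- u0) := (P :+ u0) :+
                ((y :* u1 :- u0) :* (DD :- x :* D :* Q) :+ x :* D :* (Q :* (y :* u1 :- u0) :- u1) :+ (x :* D :* u1 :- (P :+ u0))))
             Ring.refl DD Q Dₕ X xinv u1 u0 xʰ⁺¹)
    (⊕-zero-≋ (⊕-zero-≋ (⊗-zeroʳ-≋ u2 (≋⇒⊖≋0 DD-eq)) (⊗-zeroʳ-≋ (X ⊗ Dₕ) (≋⇒⊖≋0 Q-Uc)))
              (≋⇒⊖≋0 (D-Uc h₀)))

  UU-solution : UU ⊗ (u2 ⊗ u2) ≋ u1 ⊗ u1
  UU-solution = ≋-by-certificate
    (solve 7 (λ UU Q A x y u1 u0 → UU :* ((y :* u1 :- u0) :* (y :* u1 :- u0)) := u1 :* u1 :+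
                (y :* (y :* u1 :- u0) :* u1 :* (UU :- (x :* Q :+ x :* A :* UU))
                 :+ y :* x :* u1 :* (Q :* (y :* u1 :- u0) :- u1)
                 :+ y :* (y :* u1 :- u0) :* x :* UU :* (A :* u1 :- u0)
                 :+ (y :* (y :* u1 :- u0) :* UU :* u1 :- (UU :* ((y :* u1 :- u0) :* (y :* u1 :- u0)) :- u1 :* u1))
                    :* (x :* y :- con (+ 1))))
             Ring.refl UU Q Aₕ X xinv u1 u0)
    (⊕-zero-≋ (⊕-zero-≋ (⊕-zero-≋ (⊗-zeroʳ-≋ (xinv ⊗ u2 ⊗ u1) (≋⇒⊖≋0 UU-eq))
                                 (⊗-zeroʳ-≋ (xinv ⊗ X ⊗ u1) (≋⇒⊖≋0 Q-Uc)))
                        (⊗-zeroʳ-≋ (xinv ⊗ u2 ⊗ X ⊗ UU) (≋⇒⊖≋0 (A-Uc h₀))))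
              (⊗-zeroʳ-≋ (xinv ⊗ u2 ⊗ UU ⊗ u1 ⊖ (UU ⊗ (u2 ⊗ u2) ⊖ u1 ⊗ u1)) (≋⇒⊖≋0 X⊗xinv≋1)))

  DU-solution : DU ⊗ (u2 ⊗ u2) ≋ X ⊗ (xʰ ⊗ (u1 ⊕ X ⊗ u2) ⊕ const (+ 2) ⊗ (u1 ⊗ u1) ⊕ u0 ⊗ u0 ⊖ const (+ 2))
  DU-solution = ≋-by-certificate
    (solve 10 (λ DU DD UU D x y u1 u0 P P′ →
       DU :* ((y :* u1 :- u0) :* (y :* u1 :- u0))
       := x :* (P′ :* (u1 :+ x :* (y :* u1 :- u0)) :+ con (+ 2) :* (u1 :* u1) :+ u0 :* u0 :- con (+ 2)) :+
          (((y :* u1 :- u0) :* (y :* u1 :- u0)) :* (DU :- (x :* DD :+ x :* D :* UU))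
           :+ x :* (y :* u1 :- u0) :* (DD :* (y :* u1 :- u0) :- (P :+ u0))
           :+ u1 :* (x :* D :* u1 :- (P :+ u0))
           :+ x :* D :* (UU :* ((y :* u1 :- u0) :* (y :* u1 :- u0)) :- u1 :* u1)
           :+ con (ℤ.-[1+ 1 ]) :* x :* ((u0 :* u0 :+ u1 :* u1 :- y :* u0 :* u1) :- con (+ 1))
           :+ con (ℤ.-[1+ 0 ]) :* u0 :* u1 :* (x :* y :- con (+ 1))
           :+ (u1 :+ x :* (y :* u1 :- u0)) :* (P :- x :* P′)))
       Ring.refl DU DD UU Dₕ X xinv u1 u0 xʰ⁺¹ xʰ)
    (⊕-zero-≋ (⊕-zero-≋ (⊕-zero-≋ (⊕-zero-≋ (⊕-zero-≋ (⊕-zero-≋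
      (⊗-zeroʳ-≋ (u2 ⊗ u2) (≋⇒⊖≋0 DU-eq))
      (⊗-zeroʳ-≋ (X ⊗ u2) (≋⇒⊖≋0 DD-solution)))
      (⊗-zeroʳ-≋ u1 (≋⇒⊖≋0 (D-Uc h₀))))
      (⊗-zeroʳ-≋ (X ⊗ Dₕ) (≋⇒⊖≋0 UU-solution)))
      (⊗-zeroʳ-≋ (const (ℤ.-[1+ 1 ]) ⊗ X) (≋⇒⊖≋0 (Uc-cassini h₀))))
      (⊗-zeroʳ-≋ (const (ℤ.-[1+ 0 ]) ⊗ u0 ⊗ u1) (≋⇒⊖≋0 X⊗xinv≋1)))
      (⊗-zeroʳ-≋ (u1 ⊕ X ⊗ u2) (≋⇒⊖≋0 (xpow-suc h₀))))

module GeneratingFunctions (r′ : ℕ) {ud dd uu du : ℕ → ℕ}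
  (cUD : ∀ n → HasCount (Avoiding.UD r′ n) (ud n)) (cDD : ∀ n → HasCount (Avoiding.DD r′ n) (dd n))
  (cUU : ∀ n → HasCount (Avoiding.UU r′ n) (uu n)) (cDU : ∀ n → HasCount (Avoiding.DU r′ n) (du n)) where

  open Avoiding r′
  open AvoidingCounts r′

  A D : ℕ → LS
  A h = GF (udInc h)
  D h = GF (ddInc h)

  A-0 : A 0 ≋ 0ᴸ
  A-0 = wrap (λ { zero → refl ; (suc n) → refl })

  A-suc : ∀ h → A (suc h) ≋ X ⊕ X ⊗ A h ⊗ A (suc h)
  A-suc h = Ring.trans
    (GF-recurrence′ (udInc (suc h)) δ₀ (udInc h) (udInc (suc h)) (udInc-rec h) (const-cong (udInc-suc-0 h)) GF-δ₀)
    (solve 3 (λ x p q → con (+ 0) :+ x :* (con (+ 1) :+ p :* q) := x :+ x :* p :* q) Ring.refl X (A h) (A (suc h)))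

  D-0 : D 0 ≋ 1ᴸ
  D-0 = wrap (λ { zero → refl ; (suc n) → refl })

  D-suc : ∀ h → D (suc h) ≋ 1ᴸ ⊕ X ⊗ D h ⊗ A (suc h)
  D-suc h = Ring.trans
    (GF-recurrence′ (ddInc (suc h)) (λ _ → 0) (ddInc h) (udInc (suc h)) (ddInc-rec h) Ring.refl GF-0)
    (solve 3 (λ x p q → con (+ 1) :+ x :* (con (+ 0) :+ p :* q) := con (+ 1) :+ x :* p :* q) Ring.refl X (D h) (A (suc h)))

  Q : LS
  Q = GF udσ

  Q-eq : Q ≋ X ⊕ X ⊗ A r′ ⊗ Q
  Q-eq = Ring.trans
    (GF-recurrence′ udσ δ₀ (udInc r′) udσ udσ-rec (const-cong udσ-0) GF-δ₀)
    (solve 3 (λ x p q → con (+ 0) :+ x :* (con (+ 1) :+ p :* q) := x :+ x :* p :* q) Ring.refl X (A r′) Q)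

  UD-eq : GF ud ≋ X ⊗ A r′ ⊗ Q
  UD-eq = Ring.trans
    (GF-recurrence′ ud (λ _ → 0) (udInc r′) udσ (ud-rec cUD) (const-cong (count-length-0 1 cUD)) GF-0)
    (solve 3 (λ x p q → con (+ 0) :+ x :* (con (+ 0) :+ p :* q) := x :* p :* q) Ring.refl X (A r′) Q)

  UU-eq : GF uu ≋ X ⊗ Q ⊕ X ⊗ A r′ ⊗ GF uu
  UU-eq = Ring.trans
    (GF-recurrence′ uu udσ (udInc r′) uu (uu-rec cUU) (const-cong (count-length-0 0 cUU)) Ring.refl)
    (solve 4 (λ x e p q → con (+ 0) :+ x :* (e :+ p :* q) := x :* e :+ x :* p :* q) Ring.refl X Q (A r′) (GF uu))

  DD-eq : GF dd ≋ X ⊗ D r′ ⊗ Q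
  DD-eq = Ring.trans
    (GF-recurrence′ dd (λ _ → 0) (ddInc r′) udσ (dd-rec cDD) (const-cong (count-length-0 0 cDD)) GF-0)
    (solve 3 (λ x p q → con (+ 0) :+ x :* (con (+ 0) :+ p :* q) := x :* p :* q) Ring.refl X (D r′) Q)

  DU-eq : GF du ≋ X ⊗ GF dd ⊕ X ⊗ D r′ ⊗ GF uu
  DU-eq = Ring.trans
    (GF-recurrence′ du dd (ddInc r′) uu (du-rec cDD cUU cDU) (const-cong (count-length-0 1 cDU)) Ring.refl)
    (solve 4 (λ x e p q → con (+ 0) :+ x :* (e :+ p :* q) := x :* e :+ x :* p :* q) Ring.refl X (GF dd) (D r′) (GF uu))

  open ChebyshevSolution r′ A D Q (GF ud) (GF uu) (GF dd) (GF du) A-0 A-suc D-0 D-suc Q-eq UD-eq UU-eq DD-eq DU-eq public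

Av⇔ : ∀ r π → Av (suc r) π ⇔ ((¬ Has132 π) × (¬ HasSigma r π))
Av⇔ r π = mk⇔ (λ (¬132 , ¬σ) → ¬132 ∘ from Contains132⇔Has132 , ¬σ ∘ from ContainsSigma⇔HasSigma)
              (λ (¬132 , ¬σ) → ¬132 ∘ to Contains132⇔Has132 , ¬σ ∘ to ContainsSigma⇔HasSigma)

even-1≤⇒2≤ : ∀ {n} → isOdd n ≡ false → 1 ≤ n → 2 ≤ n
even-1≤⇒2≤ {suc zero}    () _
even-1≤⇒2≤ {suc (suc n)} _  _ = s≤s (s≤s z≤n)

module _ (r′ : ℕ) (n : ℕ) (π : List ℕ) where
  open Avoiding r′
  private
    k : ℕ
    k = suc (suc (suc r′))

  UpDown⇔UD : UpDown k n π ⇔ UD n π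
  UpDown⇔UD = mk⇔
    (λ (p , 2≤ , o , up , av) → 2≤ , p , (to (Odd⇔isOdd n) o , up) , to (Av⇔ _ π) av)
    (λ (2≤ , p , (o , up) , ¬132 , ¬σ) → p , 2≤ , from (Odd⇔isOdd n) o , up , from (Av⇔ _ π) (¬132 , ¬σ))

  UpUp⇔UU : UpUp k n π ⇔ UU n π
  UpUp⇔UU = mk⇔
    (λ (p , 2≤ , e , up , av) → ℕ.≤-trans (s≤s z≤n) 2≤ , p , (to (Even⇔isEven n) e , up) , to (Av⇔ _ π) av)
    (λ (1≤ , p , (e , up) , ¬132 , ¬σ) → p , even-1≤⇒2≤ e 1≤ , from (Even⇔isEven n) e , up , from (Av⇔ _ π) (¬132 , ¬σ))

  DownDown⇔DD : DownDown k n π ⇔ DD n π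
  DownDown⇔DD = mk⇔
    (λ (p , 2≤ , e , dn , av) → ℕ.≤-trans (s≤s z≤n) 2≤ , p , (to (Even⇔isEven n) e , dn) , to (Av⇔ _ π) av)
    (λ (1≤ , p , (e , dn) , ¬132 , ¬σ) → p , even-1≤⇒2≤ e 1≤ , from (Even⇔isEven n) e , dn , from (Av⇔ _ π) (¬132 , ¬σ))

  DownUp⇔DU : DownUp k n π ⇔ DU n π
  DownUp⇔DU = mk⇔
    (λ (p , 2≤ , o , dn , av) → 2≤ , p , (to (Odd⇔isOdd n) o , dn) , to (Av⇔ _ π) av)
    (λ (2≤ , p , (o , dn) , ¬132 , ¬σ) → p , 2≤ , from (Odd⇔isOdd n) o , dn , from (Av⇔ _ π) (¬132 , ¬σ))

theorem2p6 : (k : ℕ) → 3 ≤ k →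
    (ud dd uu du : ℕ → ℕ) →
    (∀ n → HasCount (UpDown k n) (ud n)) →
    (∀ n → HasCount (DownDown k n) (dd n)) →
    (∀ n → HasCount (UpUp k n) (uu n)) →
    (∀ n → HasCount (DownUp k n) (du n)) →
    -- Uc (k ∸ 3) = U_(k-4),  Uc (k ∸ 2) = U_(k-3),  Uc (k ∸ 1) = U_(k-2)
    (GF ud ⊗ Uc (k ∸ 1) ≈ xpow 1 ⊗ Uc (k ∸ 3))
    × (GF dd ⊗ Uc (k ∸ 1) ≈ xpow (k ∸ 2) ⊕ Uc (k ∸ 3))
    × (GF uu ⊗ (Uc (k ∸ 1) ⊗ Uc (k ∸ 1)) ≈ Uc (k ∸ 2) ⊗ Uc (k ∸ 2))
    × (GF du ⊗ (Uc (k ∸ 1) ⊗ Uc (k ∸ 1))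
        ≈ xpow 1 ⊗ (xpow (k ∸ 3) ⊗ (Uc (k ∸ 2) ⊕ xpow 1 ⊗ Uc (k ∸ 1))
                    ⊕ const (+ 2) ⊗ (Uc (k ∸ 2) ⊗ Uc (k ∸ 2))
                    ⊕ Uc (k ∸ 3) ⊗ Uc (k ∸ 3)
                    ⊖ const (+ 2)))
theorem2p6 (suc (suc (suc r′))) (s≤s (s≤s (s≤s _))) ud dd uu du cUD cDD cUU cDU =
  unwrap UD-solution , unwrap DD-solution , unwrap UU-solution , unwrap DU-solution
  where
  open GeneratingFunctions r′
    (λ n → HasCount-resp (UpDown⇔UD r′ n) (cUD n)) (λ n → HasCount-resp (DownDown⇔DD r′ n) (cDD n))
    (λ n → HasCount-resp (UpUp⇔UU r′ n) (cUU n)) (λ n → HasCount-resp (DownUp⇔DU r′ n) (cDU n))
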